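{- If the $p$-dimensional cubical category $\mathsf{Rel}$ has terminal objects, products and exponentials, all of which are stable under face maps and degeneracies, then for every $n\in\mathbb{N}$ the category $|\mathsf{Rel}|^n\to\mathsf{Rel}$ is cartesian closed.
   Context: Fix a finitely complete, locally small category $\mathcal{C}$; $\mathsf{Cat}(\mathcal{C})$ is the category of categories internal to $\mathcal{C}$, and all categories, functors, natural transformations, terminal objects, products and exponentials below are internal to $\mathcal{C}$ (for an internal category $\mathcal{X}$, $\mathcal{X}_0,\mathcal{X}_1$ are its objects of objects and of morphisms). Fix $p\in\mathbb{N}\cup\{\infty\}$. The category $\square$ has as objects the levels $l=\{0,\dots,l-1\}$ ($l\in\mathbb{N}$); a morphism $l_1\to l_2$ is a function $l_1\to l_2+\{\top,\bot\}$; identities are inclusions; $(g\circ f)(i)=\star$ if $f(i)=\star\in\{\top,\bot\}$ and $=g(j)$ if $f(i)=j\in\mathbb{N}$. For $\star\in\{\top,\bot\}$ and $k\le l$ the face map $\mathbf{f}_\star(l,k):l+1\to l$ sends $i\mapsto i$ ($i<k$), $k\mapsto\star$, $i\mapsto i-1$ ($i>k$); the degeneracy $\mathbf{d}(l,k):l\to l+1$ sends $i\mapsto i$ ($i<k$), $i\mapsto i+1$ ($i\ge k$). $\square_p$ is the subcategory of $\square$ generated by the levels $l\le p$ and the face maps and degeneracies with $l<p$. A ($p$-dimensional) cubical category is a functor $\mathcal{X}:\square_p\to\mathsf{Cat}(\mathcal{C})$; $|\mathcal{X}|$ is its levelwise discrete version and $\mathcal{X}^n$ its levelwise $n$-fold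 product. A cubical functor $\mathcal{F}:\mathcal{X}\to\mathcal{Y}$ is a family of functors $\mathcal{F}(l):\mathcal{X}(l)\to\mathcal{Y}(l)$, $l\le p$; it is face map-preserving if $\mathcal{Y}(h)\circ\mathcal{F}(l_1)=\mathcal{F}(l_2)\circ\mathcal{X}(h)$ for each face map $h:l_1\to l_2$ of $\square_p$, and degeneracy-preserving if for each degeneracy $h:l_1\to l_2$ of $\square_p$ it comes with a chosen natural isomorphism $\varepsilon_\mathcal{F}(h):\mathcal{Y}(h)\circ\mathcal{F}(l_1)\to\mathcal{F}(l_2)\circ\mathcal{X}(h)$. A cubical natural transformation $\eta:\mathcal{F}\to\mathcal{G}$ is a family of natural transformations $\eta(l):\mathcal{F}(l)\to\mathcal{G}(l)$; it is face map-preserving if $\mathcal{F},\mathcal{G}$ are and $\mathcal{Y}(h)(\eta(l_1)X)=\eta(l_2)(\mathcal{X}(h)X)$ for every face map $h:l_1\to l_2$ and object $X$ of $\mathcal{X}(l_1)$; it is degeneracy-preserving if $\mathcal{F},\mathcal{G}$ are and $\eta(l_2)(\mathcal{X}(h)X)\circ\varepsilon_\mathcal{F}(h)X=\varepsilon_\mathcal{G}(h)X\circ\mathcal{Y}(h)(\eta(l_1)X)$ for every degeneracy $h:l_1\to l_2$ and object $X$ of $\mathcal{X}(l_1)$. $\mathsf{Rel}$ is a $p$-dimensional cubical category equipped with a class $M=\sum_{l\le p}M(l)$ of good isomorphisms: $M(l)$ consists of morphisms $J\to\mathsf{Rel}(l)_1$ in $\mathcal{C}$ that are isomorphisms of $\mathsf{Rel}(l)$,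 contains all identities, and is closed under composition, inverses and reindexing by morphisms of $\mathcal{C}$. The category $|\mathsf{Rel}|^n\to\mathsf{Rel}$ has objects triples $(\mathcal{F},\varepsilon_\mathcal{F},\upsilon_\mathcal{F})$: $\mathcal{F}$ a face map-preserving cubical functor $|\mathsf{Rel}|^n\to\mathsf{Rel}$; $\varepsilon_\mathcal{F}$ natural isomorphisms witnessing degeneracy-preservation with $\varepsilon_\mathcal{F}(h)\in M(l_2)$ for each degeneracy $h:l_1\to l_2$; $\upsilon_\mathcal{F}$ assigns to each isomorphism $f:\mathsf{Rel}(l)_0^m\to\mathsf{Rel}(l)_1^n$ with all $\pi_k\circ f\in M(l)$ an isomorphism $\upsilon_\mathcal{F}(f):\mathsf{Rel}(l)_0^m\to\mathsf{Rel}(l)_1$ in $M(l)$, respecting source, target, identities, composition and reindexing. Its morphisms are face map- and degeneracy-preserving cubical natural transformations. $\mathsf{Rel}$ has terminal objects stable under face maps and degeneracies if there are chosen terminal objects $1_l$ of $\mathsf{Rel}(l)$ with $\mathsf{Rel}(h)1_{l_1}=1_{l_2}$ for face maps $h$, and up to an isomorphism in $M(l_2)$ for degeneracies $h$. It has products stable under face maps and degeneracies if there are chosen products $(\times_l,\mathsf{fst}_l,\mathsf{snd}_l)$ in each $\mathsf{Rel}(l)$, each $M(l)$ closed under products, such that for face maps $h:l_1\to l_2$: $\mathsf{Rel}(h)(A\times_{l_1}B)=\mathsf{Rel}(h)A\times_{l_2}\mathsf{Rel}(h)B$, $\mathsf{Rel}(h)(\mathsf{fst}_{l_1}[A,B])=\mathsf{fst}_{l_2}[\mathsf{Rel}(h)A,\mathsf{Rel}(h)B]$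 and likewise for $\mathsf{snd}$; and for degeneracies $h$ the first equation holds up to an isomorphism $\varepsilon(h,A,B)\in M(l_2)$ with $\mathsf{fst}_{l_2}[\ldots]\circ\varepsilon(h,A,B)=\mathsf{Rel}(h)(\mathsf{fst}_{l_1}[A,B])$ and likewise for $\mathsf{snd}$. It has exponentials stable under face maps and degeneracies if additionally there are chosen exponentials $(\Rightarrow_l,\mathsf{eval}_l)$ in each $\mathsf{Rel}(l)$, each $M(l)$ closed under exponentials, with $\mathsf{Rel}(h)(A\Rightarrow_{l_1}B)=\mathsf{Rel}(h)A\Rightarrow_{l_2}\mathsf{Rel}(h)B$ and $\mathsf{Rel}(h)(\mathsf{eval}_{l_1}[A,B])=\mathsf{eval}_{l_2}[\mathsf{Rel}(h)A,\mathsf{Rel}(h)B]$ for face maps $h$, and for degeneracies $h$ the first equation holding up to an isomorphism $\upsilon(h,A,B)\in M(l_2)$ with $\mathsf{eval}_{l_2}[\mathsf{Rel}(h)A,\mathsf{Rel}(h)B]\circ(\upsilon(h,A,B)\times_{l_2}1)\circ\varepsilon(h,A\Rightarrow_{l_1}B,A)=\mathsf{Rel}(h)(\mathsf{eval}_{l_1}[A,B])$. -}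

module Defs where

open import Level using (Level; _⊔_) renaming (suc to lsuc)
open import Data.Nat using (ℕ; zero; suc; _≤_)
open import Data.Nat.Properties using (≤-trans; n≤1+n)
open import Data.Fin using (Fin; punchIn; punchOut; _≟_)
  renaming (zero to fzero; suc to fsuc)
open import Data.Sum using (_⊎_; inj₁; inj₂)
open import Data.Product using (Σ; _,_) renaming (_×_ to _∧_)
open import Data.Unit using (⊤; tt)
open import Relation.Nullary using (yes; no)
open import Relation.Binary.PropositionalEquality using (_≡_)
open import Relation.Binary.Structures using (IsEquivalence)

data ℕ∞ : Set where
  fin : ℕ → ℕ∞
  ∞   : ℕ∞

_≤∞_ : ℕ → ℕ∞ → Set
l ≤∞ fin q = l ≤ q
l ≤∞ ∞     = ⊤

≤∞-pred : ∀ {l p} → suc l ≤∞ p → l ≤∞ p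
≤∞-pred {l} {fin q} h = ≤-trans (n≤1+n l) h
≤∞-pred {l} {∞}     h = tt

-- a level l with l ≤ p (the bound is proof-irrelevant, so a level is
-- determined by its natural number)
record Lvl (p : ℕ∞) : Set where
  constructor lv
  field
    lvl  : ℕ
    .bnd : lvl ≤∞ p

-- The category □ : morphisms l₁ → l₂ are functions l₁ → l₂ + {⊤,⊥}

data Sign : Set where
  top bot : Sign

Sq : ℕ → ℕ → Set
Sq l₁ l₂ = Fin l₁ → Fin l₂ ⊎ Sign

sqId : ∀ {l} → Sq l l
sqId = inj₁

_∘□_ : ∀ {l₁ l₂ l₃} → Sq l₂ l₃ → Sq l₁ l₂ → Sq l₁ l₃
(g ∘□ f) i with f i
... | inj₂ s = inj₂ s
... | inj₁ j = g j

faceSq : (s : Sign) (l : ℕ) (k : Fin (suc l)) → Sq (suc l) l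
faceSq s l k i with k ≟ i
... | yes _  = inj₂ s
... | no k≢i = inj₁ (punchOut k≢i)

degenSq : (l : ℕ) (k : Fin (suc l)) → Sq l (suc l)
degenSq l k i = inj₁ (punchIn k i)

data Face (p : ℕ∞) : Lvl p → Lvl p → Set where
  face : (s : Sign) (l : ℕ) (k : Fin (suc l)) .(lt : suc l ≤∞ p) →
         Face p (lv (suc l) lt) (lv l (≤∞-pred lt))

data Degen (p : ℕ∞) : Lvl p → Lvl p → Set where
  degen : (l : ℕ) (k : Fin (suc l)) .(lt : suc l ≤∞ p) →
          Degen p (lv l (≤∞-pred lt)) (lv (suc l) lt)

Gen : (p : ℕ∞) → Lvl p → Lvl p → Set
Gen p L N = Face p L N ⊎ Degen p L N

genSq : ∀ {p L N} → Gen p L N → Sq (Lvl.lvl L) (Lvl.lvl N)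
genSq (inj₁ (face s l k lt)) = faceSq s l k
genSq (inj₂ (degen l k lt))  = degenSq l k

-- formal composites of generators; the morphisms of □_p are exactly the
-- underlying □-morphisms of such paths
data Path (p : ℕ∞) : Lvl p → Lvl p → Set where
  []  : ∀ {L} → Path p L L
  _∷_ : ∀ {L M N} → Gen p M N → Path p L M → Path p L N

pathSq : ∀ {p L N} → Path p L N → Sq (Lvl.lvl L) (Lvl.lvl N)
pathSq []      = sqId
pathSq (g ∷ w) = genSq g ∘□ pathSq w

record Category (o ℓ e : Level) : Set (lsuc (o ⊔ ℓ ⊔ e)) where
  infixr 9 _∘_
  infix  4 _≈_
  infixr 5 _⇒_
  field
    Obj : Set o
    _⇒_ : Obj → Obj → Set ℓ
    _≈_ : ∀ {A B} → A ⇒ B → A ⇒ B → Set e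
    id  : ∀ {A} → A ⇒ A
    _∘_ : ∀ {A B C} → B ⇒ C → A ⇒ B → A ⇒ C
    ≈-equiv   : ∀ {A B} → IsEquivalence (_≈_ {A} {B})
    ∘-resp-≈  : ∀ {A B C} {f h : B ⇒ C} {g i : A ⇒ B} → f ≈ h → g ≈ i → f ∘ g ≈ h ∘ i
    assoc     : ∀ {A B C D} {f : A ⇒ B} {g : B ⇒ C} {h : C ⇒ D} → (h ∘ g) ∘ f ≈ h ∘ (g ∘ f)
    identityˡ : ∀ {A B} {f : A ⇒ B} → id ∘ f ≈ f
    identityʳ : ∀ {A B} {f : A ⇒ B} → f ∘ id ≈ f

record FinitelyComplete {o ℓ e} (C : Category o ℓ e) : Set (o ⊔ ℓ ⊔ e) where
  open Category C
  infixr 7 _×_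
  field
    ⊤ᶜ : Obj
    !  : ∀ {A} → A ⇒ ⊤ᶜ
    !-unique : ∀ {A} (f : A ⇒ ⊤ᶜ) → f ≈ !
    _×_ : Obj → Obj → Obj
    π₁  : ∀ {A B} → A × B ⇒ A
    π₂  : ∀ {A B} → A × B ⇒ B
    ⟨_,_⟩ : ∀ {A B Z} → Z ⇒ A → Z ⇒ B → Z ⇒ A × B
    π₁-β : ∀ {A B Z} {f : Z ⇒ A} {g : Z ⇒ B} → π₁ ∘ ⟨ f , g ⟩ ≈ f
    π₂-β : ∀ {A B Z} {f : Z ⇒ A} {g : Z ⇒ B} → π₂ ∘ ⟨ f , g ⟩ ≈ g
    ⟨⟩-unique : ∀ {A B Z} {f : Z ⇒ A} {g : Z ⇒ B} (h : Z ⇒ A × B) →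
                π₁ ∘ h ≈ f → π₂ ∘ h ≈ g → h ≈ ⟨ f , g ⟩
    Pb  : ∀ {A B Z} (f : A ⇒ Z) (g : B ⇒ Z) → Obj
    pb₁ : ∀ {A B Z} (f : A ⇒ Z) (g : B ⇒ Z) → Pb f g ⇒ A
    pb₂ : ∀ {A B Z} (f : A ⇒ Z) (g : B ⇒ Z) → Pb f g ⇒ B
    pb-comm : ∀ {A B Z} {f : A ⇒ Z} {g : B ⇒ Z} → f ∘ pb₁ f g ≈ g ∘ pb₂ f g
    pbpair : ∀ {A B Z J} (f : A ⇒ Z) (g : B ⇒ Z) (h : J ⇒ A) (k : J ⇒ B) →
             f ∘ h ≈ g ∘ k → J ⇒ Pb f g
    pb₁-β : ∀ {A B Z J} {f : A ⇒ Z} {g : B ⇒ Z} {h : J ⇒ A} {k : J ⇒ B} {q : f ∘ h ≈ g ∘ k} →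
            pb₁ f g ∘ pbpair f g h k q ≈ h
    pb₂-β : ∀ {A B Z J} {f : A ⇒ Z} {g : B ⇒ Z} {h : J ⇒ A} {k : J ⇒ B} {q : f ∘ h ≈ g ∘ k} →
            pb₂ f g ∘ pbpair f g h k q ≈ k
    pb-unique : ∀ {A B Z J} {f : A ⇒ Z} {g : B ⇒ Z} {h : J ⇒ A} {k : J ⇒ B} {q : f ∘ h ≈ g ∘ k}
                (u : J ⇒ Pb f g) → pb₁ f g ∘ u ≈ h → pb₂ f g ∘ u ≈ k → u ≈ pbpair f g h k q

module Setup {o ℓ e} (C : Category o ℓ e) (fc : FinitelyComplete C) where
  open Category C
  open FinitelyComplete fc

  private
    module E {A B : Obj} = IsEquivalence (≈-equiv {A} {B})

  pow : ℕ → Obj → Obj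
  pow zero    A = ⊤ᶜ
  pow (suc n) A = A × pow n A

  powMap : ∀ n {A B} → A ⇒ B → pow n A ⇒ pow n B
  powMap zero    f = !
  powMap (suc n) f = ⟨ f ∘ π₁ , powMap n f ∘ π₂ ⟩

  proj : ∀ n {A} → Fin n → pow n A ⇒ A
  proj (suc n) fzero    = π₁
  proj (suc n) (fsuc k) = proj n k ∘ π₂

  tuple : ∀ n {A J} → (Fin n → J ⇒ A) → J ⇒ pow n A
  tuple zero    fs = !
  tuple (suc n) fs = ⟨ fs fzero , tuple n (λ k → fs (fsuc k)) ⟩

  record ICatData : Set (o ⊔ ℓ) where
    field
      Ob Mor  : Obj
      src tgt : Mor ⇒ Ob
      idm     : Ob ⇒ Mor
      comp    : Pb src tgt ⇒ Mor      -- composable pairs (g , f), src g = tgt f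

  module Ops (X : ICatData) where
    open ICatData X

    Compat : ∀ {J} → J ⇒ Mor → J ⇒ Mor → Set e
    Compat g f = src ∘ g ≈ tgt ∘ f

    compose : ∀ {J} (g f : J ⇒ Mor) → Compat g f → J ⇒ Mor
    compose g f q = comp ∘ pbpair src tgt g f q

    _∙_≋_ : ∀ {J} → J ⇒ Mor → J ⇒ Mor → J ⇒ Mor → Set e
    g ∙ f ≋ h = Σ (Compat g f) λ q → compose g f q ≈ h

    CompEq : ∀ {J} → J ⇒ Mor → J ⇒ Mor → J ⇒ Mor → J ⇒ Mor → Set e
    CompEq g f g' f' = Σ (Compat g f) λ q → Σ (Compat g' f') λ q' →
                       compose g f q ≈ compose g' f' q'

    record IsInverse {J} (g f : J ⇒ Mor) : Set e where
      field
        inv-src : src ∘ g ≈ tgt ∘ f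
        inv-tgt : tgt ∘ g ≈ src ∘ f
        invˡ    : g ∙ f ≋ (idm ∘ (src ∘ f))
        invʳ    : f ∙ g ≋ (idm ∘ (tgt ∘ f))

    IsIso : ∀ {J} → J ⇒ Mor → Set (ℓ ⊔ e)
    IsIso {J} f = Σ (J ⇒ Mor) λ g → IsInverse g f

  record ICat : Set (o ⊔ ℓ ⊔ e) where
    field
      dat : ICatData
    open ICatData dat public
    open Ops dat public
    field
      src-idm  : src ∘ idm ≈ id
      tgt-idm  : tgt ∘ idm ≈ id
      src-comp : src ∘ comp ≈ src ∘ pb₂ src tgt
      tgt-comp : tgt ∘ comp ≈ tgt ∘ pb₁ src tgt
      idˡ : ∀ {J} (f : J ⇒ Mor) (q : Compat (idm ∘ (tgt ∘ f)) f) →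
            compose (idm ∘ (tgt ∘ f)) f q ≈ f
      idʳ : ∀ {J} (f : J ⇒ Mor) (q : Compat f (idm ∘ (src ∘ f))) →
            compose f (idm ∘ (src ∘ f)) q ≈ f
      cassoc : ∀ {J} (h g f : J ⇒ Mor) (p : Compat h g) (q : Compat g f)
               (r : Compat (compose h g p) f) (s : Compat h (compose g f q)) →
               compose (compose h g p) f r ≈ compose h (compose g f q) s

  record IFun (X Y : ICat) : Set (o ⊔ ℓ ⊔ e) where
    private
      module X = ICat X
      module Y = ICat Y
    field
      fob  : X.Ob ⇒ Y.Ob
      fmor : X.Mor ⇒ Y.Mor
      fsrc : Y.src ∘ fmor ≈ fob ∘ X.src
      ftgt : Y.tgt ∘ fmor ≈ fob ∘ X.tgt
      fidm : fmor ∘ X.idm ≈ Y.idm ∘ fob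
      fcomp : ∀ {J} (g f : J ⇒ X.Mor) (p : X.Compat g f) (q : Y.Compat (fmor ∘ g) (fmor ∘ f)) →
              fmor ∘ X.compose g f p ≈ Y.compose (fmor ∘ g) (fmor ∘ f) q

  record INat (X Y : ICat) (F₀ G₀ : ICat.Ob X ⇒ ICat.Ob Y) (F₁ G₁ : ICat.Mor X ⇒ ICat.Mor Y)
              : Set (o ⊔ ℓ ⊔ e) where
    private
      module X = ICat X
      module Y = ICat Y
    field
      cmp     : X.Ob ⇒ Y.Mor
      cmp-src : Y.src ∘ cmp ≈ F₀
      cmp-tgt : Y.tgt ∘ cmp ≈ G₀
      natural : Y.CompEq G₁ (cmp ∘ X.src) (cmp ∘ X.tgt) F₁

  Disc : Obj → ICat
  Disc A = record
    { dat = record { Ob = A ; Mor = A ; src = id ; tgt = id ; idm = id ; comp = pb₁ id id }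
    ; src-idm  = identityˡ
    ; tgt-idm  = identityˡ
    ; src-comp = pb-comm
    ; tgt-comp = E.refl
    ; idˡ = λ f q → E.trans pb₁-β (E.trans identityˡ identityˡ)
    ; idʳ = λ f q → pb₁-β
    ; cassoc = λ h g f p q r s → E.trans (E.trans pb₁-β pb₁-β) (E.sym pb₁-β)
    }

  -- (p-dimensional) cubical categories : functors □_p → Cat(C)

  module _ {p : ℕ∞} (cat : Lvl p → ICat) (gen : ∀ {L N} → Gen p L N → IFun (cat L) (cat N)) where
    pathOb : ∀ {L N} → Path p L N → ICat.Ob (cat L) ⇒ ICat.Ob (cat N)
    pathOb []      = id
    pathOb (g ∷ w) = IFun.fob (gen g) ∘ pathOb w

    pathMor : ∀ {L N} → Path p L N → ICat.Mor (cat L) ⇒ ICat.Mor (cat N)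
    pathMor []      = id
    pathMor (g ∷ w) = IFun.fmor (gen g) ∘ pathMor w

  record CubicalCategory (p : ℕ∞) : Set (o ⊔ ℓ ⊔ e) where
    field
      cat : Lvl p → ICat
      gen : ∀ {L N} → Gen p L N → IFun (cat L) (cat N)
      -- well defined on □_p : composites with the same underlying morphism of □
      -- are sent to the same internal functor
      functorial : ∀ {L N} (w w' : Path p L N) → (∀ i → pathSq w i ≡ pathSq w' i) →
                   (pathOb cat gen w ≈ pathOb cat gen w') ∧ (pathMor cat gen w ≈ pathMor cat gen w')

  module Cubes {p : ℕ∞} (Rel : CubicalCategory p) where
    open CubicalCategory Rel

    module R (L : Lvl p) = ICat (cat L)

    hob : ∀ {L N} → Gen p L N → R.Ob L ⇒ R.Ob N
    hob h = IFun.fob (gen h)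

    hmor : ∀ {L N} → Gen p L N → R.Mor L ⇒ R.Mor N
    hmor h = IFun.fmor (gen h)

    hob² : ∀ {L N} → Gen p L N → R.Ob L × R.Ob L ⇒ R.Ob N × R.Ob N
    hob² h = ⟨ hob h ∘ π₁ , hob h ∘ π₂ ⟩

    record GoodIsos (ℓm : Level) : Set (o ⊔ ℓ ⊔ e ⊔ lsuc ℓm) where
      field
        M : (L : Lvl p) → ∀ {J} → J ⇒ R.Mor L → Set ℓm
        M-iso  : ∀ {L J} {f : J ⇒ R.Mor L} → M L f → R.IsIso L f
        M-resp : ∀ {L J} {f g : J ⇒ R.Mor L} → f ≈ g → M L f → M L g
        M-id   : ∀ {L J} (A : J ⇒ R.Ob L) → M L (R.idm L ∘ A)
        M-comp : ∀ {L J} {g f h : J ⇒ R.Mor L} → M L g → M L f → R._∙_≋_ L g f h → M L h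
        M-inv  : ∀ {L J} {f g : J ⇒ R.Mor L} → M L f → R.IsInverse L g f → M L g
        M-reindex : ∀ {L J J'} {f : J ⇒ R.Mor L} (u : J' ⇒ J) → M L f → M L (f ∘ u)

    module WithM {ℓm} (GI : GoodIsos ℓm) where
      open GoodIsos GI

      record StableTerminals : Set (o ⊔ ℓ ⊔ e ⊔ ℓm) where
        field
          one : (L : Lvl p) → ⊤ᶜ ⇒ R.Ob L
          term : ∀ L {J} (A : J ⇒ R.Ob L) → J ⇒ R.Mor L
          term-src : ∀ L {J} (A : J ⇒ R.Ob L) → R.src L ∘ term L A ≈ A
          term-tgt : ∀ L {J} (A : J ⇒ R.Ob L) → R.tgt L ∘ term L A ≈ one L ∘ !
          term-unique : ∀ L {J} (A : J ⇒ R.Ob L) (f : J ⇒ R.Mor L) →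
                        R.src L ∘ f ≈ A → R.tgt L ∘ f ≈ one L ∘ ! → f ≈ term L A
          one-face : ∀ {L N} (h : Face p L N) → hob (inj₁ h) ∘ one L ≈ one N
          one-degen : ∀ {L N} (h : Degen p L N) → ⊤ᶜ ⇒ R.Mor N
          one-degen-src : ∀ {L N} (h : Degen p L N) → R.src N ∘ one-degen h ≈ hob (inj₂ h) ∘ one L
          one-degen-tgt : ∀ {L N} (h : Degen p L N) → R.tgt N ∘ one-degen h ≈ one N
          one-degen-M : ∀ {L N} (h : Degen p L N) → M N (one-degen h)

      IsProdMor : ∀ L (prod : R.Ob L × R.Ob L ⇒ R.Ob L) (fst snd : R.Ob L × R.Ob L ⇒ R.Mor L)
                  {J} (f g h : J ⇒ R.Mor L) → Set e
      IsProdMor L prod fst snd f g h =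
        (R.src L ∘ h ≈ prod ∘ ⟨ R.src L ∘ f , R.src L ∘ g ⟩) ∧
        (R.tgt L ∘ h ≈ prod ∘ ⟨ R.tgt L ∘ f , R.tgt L ∘ g ⟩) ∧
        R.CompEq L (fst ∘ ⟨ R.tgt L ∘ f , R.tgt L ∘ g ⟩) h f (fst ∘ ⟨ R.src L ∘ f , R.src L ∘ g ⟩) ∧
        R.CompEq L (snd ∘ ⟨ R.tgt L ∘ f , R.tgt L ∘ g ⟩) h g (snd ∘ ⟨ R.src L ∘ f , R.src L ∘ g ⟩)

      record StableProducts : Set (o ⊔ ℓ ⊔ e ⊔ ℓm) where
        field
          prod : ∀ L → R.Ob L × R.Ob L ⇒ R.Ob L
          fst  : ∀ L → R.Ob L × R.Ob L ⇒ R.Mor L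
          snd  : ∀ L → R.Ob L × R.Ob L ⇒ R.Mor L
          fst-src : ∀ L → R.src L ∘ fst L ≈ prod L
          fst-tgt : ∀ L → R.tgt L ∘ fst L ≈ π₁
          snd-src : ∀ L → R.src L ∘ snd L ≈ prod L
          snd-tgt : ∀ L → R.tgt L ∘ snd L ≈ π₂
          pair : ∀ L {J} (f g : J ⇒ R.Mor L) → R.src L ∘ f ≈ R.src L ∘ g → J ⇒ R.Mor L
          pair-src : ∀ L {J} (f g : J ⇒ R.Mor L) (p : R.src L ∘ f ≈ R.src L ∘ g) →
                     R.src L ∘ pair L f g p ≈ R.src L ∘ f
          pair-tgt : ∀ L {J} (f g : J ⇒ R.Mor L) (p : R.src L ∘ f ≈ R.src L ∘ g) →
                     R.tgt L ∘ pair L f g p ≈ prod L ∘ ⟨ R.tgt L ∘ f , R.tgt L ∘ g ⟩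
          pair-fst : ∀ L {J} (f g : J ⇒ R.Mor L) (p : R.src L ∘ f ≈ R.src L ∘ g) →
                     R._∙_≋_ L (fst L ∘ ⟨ R.tgt L ∘ f , R.tgt L ∘ g ⟩) (pair L f g p) f
          pair-snd : ∀ L {J} (f g : J ⇒ R.Mor L) (p : R.src L ∘ f ≈ R.src L ∘ g) →
                     R._∙_≋_ L (snd L ∘ ⟨ R.tgt L ∘ f , R.tgt L ∘ g ⟩) (pair L f g p) g
          pair-unique : ∀ L {J} (f g : J ⇒ R.Mor L) (p : R.src L ∘ f ≈ R.src L ∘ g) (h : J ⇒ R.Mor L) →
                        R.src L ∘ h ≈ R.src L ∘ f →
                        R.tgt L ∘ h ≈ prod L ∘ ⟨ R.tgt L ∘ f , R.tgt L ∘ g ⟩ →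
                        R._∙_≋_ L (fst L ∘ ⟨ R.tgt L ∘ f , R.tgt L ∘ g ⟩) h f →
                        R._∙_≋_ L (snd L ∘ ⟨ R.tgt L ∘ f , R.tgt L ∘ g ⟩) h g →
                        h ≈ pair L f g p
          M-prod : ∀ L {J} (f g h : J ⇒ R.Mor L) → M L f → M L g →
                   IsProdMor L (prod L) (fst L) (snd L) f g h → M L h
          prod-face : ∀ {L N} (h : Face p L N) → hob (inj₁ h) ∘ prod L ≈ prod N ∘ hob² (inj₁ h)
          fst-face  : ∀ {L N} (h : Face p L N) → hmor (inj₁ h) ∘ fst L ≈ fst N ∘ hob² (inj₁ h)
          snd-face  : ∀ {L N} (h : Face p L N) → hmor (inj₁ h) ∘ snd L ≈ snd N ∘ hob² (inj₁ h)
          ε : ∀ {L N} (h : Degen p L N) → R.Ob L × R.Ob L ⇒ R.Mor N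
          ε-src : ∀ {L N} (h : Degen p L N) → R.src N ∘ ε h ≈ hob (inj₂ h) ∘ prod L
          ε-tgt : ∀ {L N} (h : Degen p L N) → R.tgt N ∘ ε h ≈ prod N ∘ hob² (inj₂ h)
          ε-M   : ∀ {L N} (h : Degen p L N) → M N (ε h)
          ε-fst : ∀ {L N} (h : Degen p L N) →
                  R._∙_≋_ N (fst N ∘ hob² (inj₂ h)) (ε h) (hmor (inj₂ h) ∘ fst L)
          ε-snd : ∀ {L N} (h : Degen p L N) →
                  R._∙_≋_ N (snd N ∘ hob² (inj₂ h)) (ε h) (hmor (inj₂ h) ∘ snd L)

      module WithProducts (P : StableProducts) where
        open StableProducts P

        ProdMor : ∀ L {J} (f g h : J ⇒ R.Mor L) → Set e
        ProdMor L = IsProdMor L (prod L) (fst L) (snd L)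

        -- stable exponentials ( exp L ∘ ⟨ A , B ⟩ = A ⇒ B ,
        -- eval L ∘ ⟨ A , B ⟩ : (A ⇒ B) × A → B )
        record StableExponentials : Set (o ⊔ ℓ ⊔ e ⊔ ℓm) where
          field
            exp  : ∀ L → R.Ob L × R.Ob L ⇒ R.Ob L
            eval : ∀ L → R.Ob L × R.Ob L ⇒ R.Mor L
            eval-src : ∀ L → R.src L ∘ eval L ≈ prod L ∘ ⟨ exp L , π₁ ⟩
            eval-tgt : ∀ L → R.tgt L ∘ eval L ≈ π₂
            curry : ∀ L {J} (Z A B : J ⇒ R.Ob L) (f : J ⇒ R.Mor L) →
                    R.src L ∘ f ≈ prod L ∘ ⟨ Z , A ⟩ → R.tgt L ∘ f ≈ B → J ⇒ R.Mor L
            curry-src : ∀ L {J} (Z A B : J ⇒ R.Ob L) (f : J ⇒ R.Mor L) p q →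
                        R.src L ∘ curry L Z A B f p q ≈ Z
            curry-tgt : ∀ L {J} (Z A B : J ⇒ R.Ob L) (f : J ⇒ R.Mor L) p q →
                        R.tgt L ∘ curry L Z A B f p q ≈ exp L ∘ ⟨ A , B ⟩
            curry-β : ∀ L {J} (Z A B : J ⇒ R.Ob L) (f : J ⇒ R.Mor L) p q →
                      Σ (J ⇒ R.Mor L) λ m → ProdMor L (curry L Z A B f p q) (R.idm L ∘ A) m ∧
                                            R._∙_≋_ L (eval L ∘ ⟨ A , B ⟩) m f
            curry-unique : ∀ L {J} (Z A B : J ⇒ R.Ob L) (f : J ⇒ R.Mor L) p q (g : J ⇒ R.Mor L) →
                           R.src L ∘ g ≈ Z → R.tgt L ∘ g ≈ exp L ∘ ⟨ A , B ⟩ →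
                           (Σ (J ⇒ R.Mor L) λ m → ProdMor L g (R.idm L ∘ A) m ∧
                                                   R._∙_≋_ L (eval L ∘ ⟨ A , B ⟩) m f) →
                           g ≈ curry L Z A B f p q
            -- M closed under exponentials: for f : A → A', g : B → B',
            -- f ⇒ g : (A' ⇒ B) → (A ⇒ B') is the unique h with
            -- eval[A,B'] ∘ (h × A) = g ∘ eval[A',B] ∘ ((A' ⇒ B) × f)
            M-exp : ∀ L {J} (f g h : J ⇒ R.Mor L) → M L f → M L g →
                    R.src L ∘ h ≈ exp L ∘ ⟨ R.tgt L ∘ f , R.src L ∘ g ⟩ →
                    R.tgt L ∘ h ≈ exp L ∘ ⟨ R.src L ∘ f , R.tgt L ∘ g ⟩ →
                    (Σ (J ⇒ R.Mor L) λ m₁ → Σ (J ⇒ R.Mor L) λ m₂ → Σ (J ⇒ R.Mor L) λ c →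
                       ProdMor L h (R.idm L ∘ (R.src L ∘ f)) m₁ ∧
                       ProdMor L (R.idm L ∘ (R.src L ∘ h)) f m₂ ∧
                       R._∙_≋_ L g (eval L ∘ ⟨ R.tgt L ∘ f , R.src L ∘ g ⟩) c ∧
                       R.CompEq L (eval L ∘ ⟨ R.src L ∘ f , R.tgt L ∘ g ⟩) m₁ c m₂) →
                    M L h
            exp-face  : ∀ {L N} (h : Face p L N) → hob (inj₁ h) ∘ exp L ≈ exp N ∘ hob² (inj₁ h)
            eval-face : ∀ {L N} (h : Face p L N) → hmor (inj₁ h) ∘ eval L ≈ eval N ∘ hob² (inj₁ h)
            υ : ∀ {L N} (h : Degen p L N) → R.Ob L × R.Ob L ⇒ R.Mor N
            υ-src : ∀ {L N} (h : Degen p L N) → R.src N ∘ υ h ≈ hob (inj₂ h) ∘ exp L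
            υ-tgt : ∀ {L N} (h : Degen p L N) → R.tgt N ∘ υ h ≈ exp N ∘ hob² (inj₂ h)
            υ-M   : ∀ {L N} (h : Degen p L N) → M N (υ h)
            υ-eval : ∀ {L N} (h : Degen p L N) →
                     Σ (R.Ob L × R.Ob L ⇒ R.Mor N) λ m → Σ (R.Ob L × R.Ob L ⇒ R.Mor N) λ c →
                       ProdMor N (υ h) (R.idm N ∘ (hob (inj₂ h) ∘ π₁)) m ∧
                       R._∙_≋_ N (eval N ∘ hob² (inj₂ h)) m c ∧
                       R._∙_≋_ N c (ε h ∘ ⟨ exp L , π₁ ⟩) (hmor (inj₂ h) ∘ eval L)

      module FunCat (n : ℕ) where

        D : (L : Lvl p) → ICat
        D L = Disc (pow n (R.Ob L))

        record FObj : Set (o ⊔ ℓ ⊔ e ⊔ ℓm) where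
          field
            fun : (L : Lvl p) → IFun (D L) (cat L)
          F₀ : (L : Lvl p) → pow n (R.Ob L) ⇒ R.Ob L
          F₀ L = IFun.fob (fun L)
          F₁ : (L : Lvl p) → pow n (R.Ob L) ⇒ R.Mor L
          F₁ L = IFun.fmor (fun L)
          field
            face₀ : ∀ {L N} (h : Face p L N) → hob (inj₁ h) ∘ F₀ L ≈ F₀ N ∘ powMap n (hob (inj₁ h))
            face₁ : ∀ {L N} (h : Face p L N) → hmor (inj₁ h) ∘ F₁ L ≈ F₁ N ∘ powMap n (hob (inj₁ h))
            ε : ∀ {L N} (h : Degen p L N) →
                INat (D L) (cat N) (hob (inj₂ h) ∘ F₀ L) (F₀ N ∘ powMap n (hob (inj₂ h)))
                                   (hmor (inj₂ h) ∘ F₁ L) (F₁ N ∘ powMap n (hob (inj₂ h)))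
            ε-iso : ∀ {L N} (h : Degen p L N) → R.IsIso N (INat.cmp (ε h))
            ε-M   : ∀ {L N} (h : Degen p L N) → M N (INat.cmp (ε h))
            υ : ∀ L m (f : pow m (R.Ob L) ⇒ pow n (R.Mor L)) →
                (∀ k → M L (proj n k ∘ f)) → pow m (R.Ob L) ⇒ R.Mor L
            υ-M : ∀ L m (f : pow m (R.Ob L) ⇒ pow n (R.Mor L)) mf → M L (υ L m f mf)
            υ-src : ∀ L m (f : pow m (R.Ob L) ⇒ pow n (R.Mor L)) mf →
                    R.src L ∘ υ L m f mf ≈ F₀ L ∘ (powMap n (R.src L) ∘ f)
            υ-tgt : ∀ L m (f : pow m (R.Ob L) ⇒ pow n (R.Mor L)) mf →
                    R.tgt L ∘ υ L m f mf ≈ F₀ L ∘ (powMap n (R.tgt L) ∘ f)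
            υ-resp : ∀ L m (f f' : pow m (R.Ob L) ⇒ pow n (R.Mor L)) mf mf' →
                     f ≈ f' → υ L m f mf ≈ υ L m f' mf'
            υ-id : ∀ L m (A : pow m (R.Ob L) ⇒ pow n (R.Ob L)) mf →
                   υ L m (powMap n (R.idm L) ∘ A) mf ≈ R.idm L ∘ (F₀ L ∘ A)
            υ-comp : ∀ L m (f' f : pow m (R.Ob L) ⇒ pow n (R.Mor L))
                     (ps : ∀ k → R.Compat L (proj n k ∘ f') (proj n k ∘ f)) mf'' mf' mf →
                     R._∙_≋_ L (υ L m f' mf') (υ L m f mf)
                       (υ L m (tuple n (λ k → R.compose L (proj n k ∘ f') (proj n k ∘ f) (ps k))) mf'')
            υ-reindex : ∀ L m m' (f : pow m (R.Ob L) ⇒ pow n (R.Mor L))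
                        (g : pow m' (R.Ob L) ⇒ pow m (R.Ob L)) mf mfg →
                        υ L m' (f ∘ g) mfg ≈ υ L m f mf ∘ g

        record FHom (F G : FObj) : Set (o ⊔ ℓ ⊔ e ⊔ ℓm) where
          private
            module F = FObj F
            module G = FObj G
          field
            η : ∀ L → INat (D L) (cat L) (F.F₀ L) (G.F₀ L) (F.F₁ L) (G.F₁ L)
            η-face : ∀ {L N} (h : Face p L N) →
                     hmor (inj₁ h) ∘ INat.cmp (η L) ≈ INat.cmp (η N) ∘ powMap n (hob (inj₁ h))
            η-degen : ∀ {L N} (h : Degen p L N) →
                      R.CompEq N (INat.cmp (η N) ∘ powMap n (hob (inj₂ h))) (INat.cmp (F.ε h))
                                 (INat.cmp (G.ε h)) (hmor (inj₂ h) ∘ INat.cmp (η L))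

        -- underlying components of a (possibly composite) morphism
        Raw : Set ℓ
        Raw = (L : Lvl p) → pow n (R.Ob L) ⇒ R.Mor L

        ⌜_⌝ : ∀ {F G} → FHom F G → Raw
        ⌜ η ⌝ L = INat.cmp (FHom.η η L)

        _∘ᶠ_ : ∀ {F G H} → FHom G H → FHom F G → Raw
        (η ∘ᶠ θ) L = R.compose L (⌜ η ⌝ L) (⌜ θ ⌝ L)
                       (E.trans (INat.cmp-src (FHom.η η L)) (E.sym (INat.cmp-tgt (FHom.η θ L))))

        _≈ᶠ_ : Raw → Raw → Set e
        r ≈ᶠ r' = ∀ L → r L ≈ r' L

        record CartesianClosed : Set (o ⊔ ℓ ⊔ e ⊔ ℓm) where
          field
            ⊤F : FObj
            !F : ∀ A → FHom A ⊤F
            !F-unique : ∀ A (f : FHom A ⊤F) → ⌜ f ⌝ ≈ᶠ ⌜ !F A ⌝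
            _×F_ : FObj → FObj → FObj
            π₁F : ∀ {A B} → FHom (A ×F B) A
            π₂F : ∀ {A B} → FHom (A ×F B) B
            ⟨_,_⟩F : ∀ {A B Z} → FHom Z A → FHom Z B → FHom Z (A ×F B)
            π₁F-β : ∀ {A B Z} (f : FHom Z A) (g : FHom Z B) → (π₁F ∘ᶠ ⟨ f , g ⟩F) ≈ᶠ ⌜ f ⌝
            π₂F-β : ∀ {A B Z} (f : FHom Z A) (g : FHom Z B) → (π₂F ∘ᶠ ⟨ f , g ⟩F) ≈ᶠ ⌜ g ⌝
            ⟨⟩F-unique : ∀ {A B Z} (f : FHom Z A) (g : FHom Z B) (h : FHom Z (A ×F B)) →
                         (π₁F ∘ᶠ h) ≈ᶠ ⌜ f ⌝ → (π₂F ∘ᶠ h) ≈ᶠ ⌜ g ⌝ → ⌜ h ⌝ ≈ᶠ ⌜ ⟨ f , g ⟩F ⌝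
            _^F_ : FObj → FObj → FObj
            evalF : ∀ {A B} → FHom ((B ^F A) ×F A) B
            curryF : ∀ {A B Z} → FHom (Z ×F A) B → FHom Z (B ^F A)
            curryF-β : ∀ {A B Z} (f : FHom (Z ×F A) B) →
                       Σ (FHom (Z ×F A) ((B ^F A) ×F A)) λ m →
                         ((π₁F {B ^F A} {A} ∘ᶠ m) ≈ᶠ (curryF f ∘ᶠ π₁F {Z} {A})) ∧ ((π₂F {B ^F A} {A} ∘ᶠ m) ≈ᶠ ⌜ π₂F {Z} {A} ⌝) ∧
                         ((evalF {A} {B} ∘ᶠ m) ≈ᶠ ⌜ f ⌝)
            curryF-unique : ∀ {A B Z} (f : FHom (Z ×F A) B) (g : FHom Z (B ^F A))
                            (m : FHom (Z ×F A) ((B ^F A) ×F A)) →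
                            (π₁F {B ^F A} {A} ∘ᶠ m) ≈ᶠ (g ∘ᶠ π₁F {Z} {A}) → (π₂F {B ^F A} {A} ∘ᶠ m) ≈ᶠ ⌜ π₂F {Z} {A} ⌝ →
                            (evalF {A} {B} ∘ᶠ m) ≈ᶠ ⌜ f ⌝ → ⌜ g ⌝ ≈ᶠ ⌜ curryF f ⌝

module Submission where

-- Everything in |Rel|ⁿ → Rel is computed levelwise: (F × G)(l) = F(l) × G(l),
-- (G ^ F)(l) = F(l) ⇒ G(l), 1(l) = 1_l, and the universal properties are those
-- of Rel(l), checked on generalized elements. Face maps preserve the chosen
-- structure strictly, so the levelwise constructions are face map-preserving.
-- For a degeneracy h the comparison isomorphism of F × G is (ε_F × ε_G) ∘ ε(h),
-- that of G ^ F is (ε_F⁻¹ ⇒ ε_G) ∘ υ(h), and the actions on good isomorphisms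
-- are υ_F × υ_G and υ_F⁻¹ ⇒ υ_G; closure of M under composition, inverses,
-- products and exponentials keeps them good. Projections, pairing and
-- evaluation preserve degeneracies by naturality of ε(h) and the compatibility
-- of υ(h) with evaluation; currying then follows from the universal property
-- of the exponential.

open import Level using (_⊔_)
open import Data.Nat using (ℕ)
open import Data.Product using (Σ; _,_; proj₂) renaming (_×_ to _∧_)
open import Data.Sum using (inj₁; inj₂)
open import Relation.Binary.Structures using (IsEquivalence)
open import Defs

module InternalArrows {o ℓ e} {C : Category o ℓ e} (fc : FinitelyComplete C) where
  open Category C public
  open FinitelyComplete fc public
  open Setup C fc public

  module ≈ {A B : Obj} = IsEquivalence (≈-equiv {A} {B})

  ∘-congˡ : ∀ {A B D} (h : B ⇒ D) {f g : A ⇒ B} → f ≈ g → h ∘ f ≈ h ∘ g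
  ∘-congˡ h p = ∘-resp-≈ ≈.refl p

  ∘-congʳ : ∀ {A B D} {f g : B ⇒ D} → f ≈ g → (u : A ⇒ B) → f ∘ u ≈ g ∘ u
  ∘-congʳ p u = ∘-resp-≈ p ≈.refl

  assoc˘ : ∀ {A B D E} {f : A ⇒ B} {g : B ⇒ D} {h : D ⇒ E} → h ∘ (g ∘ f) ≈ (h ∘ g) ∘ f
  assoc˘ = ≈.sym assoc

  ⟨⟩-cong : ∀ {A B Z} {f f' : Z ⇒ A} {g g' : Z ⇒ B} → f ≈ f' → g ≈ g' → ⟨ f , g ⟩ ≈ ⟨ f' , g' ⟩
  ⟨⟩-cong p q = ⟨⟩-unique _ (≈.trans π₁-β p) (≈.trans π₂-β q)

  ⟨⟩∘ : ∀ {A B Z Z'} {f : Z ⇒ A} {g : Z ⇒ B} {u : Z' ⇒ Z} → ⟨ f , g ⟩ ∘ u ≈ ⟨ f ∘ u , g ∘ u ⟩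
  ⟨⟩∘ = ⟨⟩-unique _ (≈.trans assoc˘ (∘-congʳ π₁-β _)) (≈.trans assoc˘ (∘-congʳ π₂-β _))

  -- An internal category is handled through its arrows between generalized
  -- objects J ⇒ Ob: at each stage J they form an ordinary category.
  module Arrows (X : ICat) where
    open ICat X

    record Hom {J} (A B : J ⇒ Ob) : Set (ℓ ⊔ e) where
      constructor hom
      field
        arr     : J ⇒ Mor
        arr-src : src ∘ arr ≈ A
        arr-tgt : tgt ∘ arr ≈ B
    open Hom public

    infix 4 _≃_
    record _≃_ {J} {A B A' B' : J ⇒ Ob} (f : Hom A B) (g : Hom A' B') : Set e where
      constructor ≈⇒≃
      field ≃⇒≈ : arr f ≈ arr g
    open _≃_ public

    module _ {J : Obj} where
      ≃-refl : {A B : J ⇒ Ob} {f : Hom A B} → f ≃ f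
      ≃-refl = ≈⇒≃ ≈.refl

      ≃-sym : {A B A' B' : J ⇒ Ob} {f : Hom A B} {g : Hom A' B'} → f ≃ g → g ≃ f
      ≃-sym (≈⇒≃ p) = ≈⇒≃ (≈.sym p)

      ≃-trans : {A B A' B' A'' B'' : J ⇒ Ob} {f : Hom A B} {g : Hom A' B'} {h : Hom A'' B''} →
                f ≃ g → g ≃ h → f ≃ h
      ≃-trans (≈⇒≃ p) (≈⇒≃ q) = ≈⇒≃ (≈.trans p q)

      ≃-src : {A B A' B' : J ⇒ Ob} {f : Hom A B} {g : Hom A' B'} → f ≃ g → A ≈ A'
      ≃-src {f = f} {g} (≈⇒≃ p) = ≈.trans (≈.sym (arr-src f)) (≈.trans (∘-congˡ src p) (arr-src g))

      ≃-tgt : {A B A' B' : J ⇒ Ob} {f : Hom A B} {g : Hom A' B'} → f ≃ g → B ≈ B'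
      ≃-tgt {f = f} {g} (≈⇒≃ p) = ≈.trans (≈.sym (arr-tgt f)) (≈.trans (∘-congˡ tgt p) (arr-tgt g))

    module ≃-Reasoning {J : Obj} where
      infix  1 begin_
      infixr 2 step-≃ step-≃˘
      infix  3 _∎

      begin_ : {A B A' B' : J ⇒ Ob} {f : Hom A B} {g : Hom A' B'} → f ≃ g → f ≃ g
      begin p = p

      step-≃ : {A B A' B' A'' B'' : J ⇒ Ob} (f : Hom A B) {g : Hom A' B'} {h : Hom A'' B''} →
               g ≃ h → f ≃ g → f ≃ h
      step-≃ f q p = ≃-trans p q

      step-≃˘ : {A B A' B' A'' B'' : J ⇒ Ob} (f : Hom A B) {g : Hom A' B'} {h : Hom A'' B''} →
                g ≃ h → g ≃ f → f ≃ h
      step-≃˘ f q p = ≃-trans (≃-sym p) q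

      syntax step-≃ f q p = f ≃⟨ p ⟩ q
      syntax step-≃˘ f q p = f ≃˘⟨ p ⟩ q

      _∎ : {A B : J ⇒ Ob} (f : Hom A B) → f ≃ f
      f ∎ = ≃-refl

    module _ {J : Obj} where
      pbpair-cong : {g g' f f' : J ⇒ Mor} {q : Compat g f} {q' : Compat g' f'} →
                    g ≈ g' → f ≈ f' → pbpair src tgt g f q ≈ pbpair src tgt g' f' q'
      pbpair-cong a b = pb-unique _ (≈.trans pb₁-β a) (≈.trans pb₂-β b)

      compose-cong : {g g' f f' : J ⇒ Mor} {q : Compat g f} {q' : Compat g' f'} →
                     g ≈ g' → f ≈ f' → compose g f q ≈ compose g' f' q'
      compose-cong a b = ∘-congˡ comp (pbpair-cong a b)

      src-compose : {g f : J ⇒ Mor} {q : Compat g f} → src ∘ compose g f q ≈ src ∘ f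
      src-compose = ≈.trans assoc˘ (≈.trans (∘-congʳ src-comp _) (≈.trans assoc (∘-congˡ src pb₂-β)))

      tgt-compose : {g f : J ⇒ Mor} {q : Compat g f} → tgt ∘ compose g f q ≈ tgt ∘ g
      tgt-compose = ≈.trans assoc˘ (≈.trans (∘-congʳ tgt-comp _) (≈.trans assoc (∘-congˡ tgt pb₁-β)))

      compose-∘ : ∀ {J'} {g f : J ⇒ Mor} {q : Compat g f} {u : J' ⇒ J} {q' : Compat (g ∘ u) (f ∘ u)} →
                  compose g f q ∘ u ≈ compose (g ∘ u) (f ∘ u) q'
      compose-∘ = ≈.trans assoc (∘-congˡ comp (pb-unique _ (≈.trans assoc˘ (∘-congʳ pb₁-β _))
                                                         (≈.trans assoc˘ (∘-congʳ pb₂-β _))))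

      infixr 9 _⊚_
      opaque
        _⊚_ : {A B D : J ⇒ Ob} → Hom B D → Hom A B → Hom A D
        g ⊚ f = hom (compose (arr g) (arr f) (≈.trans (arr-src g) (≈.sym (arr-tgt f))))
                    (≈.trans src-compose (arr-src f)) (≈.trans tgt-compose (arr-tgt g))

      idH : (A : J ⇒ Ob) → Hom A A
      idH A = hom (idm ∘ A) (≈.trans assoc˘ (≈.trans (∘-congʳ src-idm _) identityˡ))
                            (≈.trans assoc˘ (≈.trans (∘-congʳ tgt-idm _) identityˡ))

      cast : {A B A' B' : J ⇒ Ob} → A ≈ A' → B ≈ B' → Hom A B → Hom A' B'
      cast a b f = hom (arr f) (≈.trans (arr-src f) a) (≈.trans (arr-tgt f) b)

      cast-≃ : {A B A' B' : J ⇒ Ob} {a : A ≈ A'} {b : B ≈ B'} (f : Hom A B) → cast a b f ≃ f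
      cast-≃ f = ≈⇒≃ ≈.refl

      ≃-cast : {A B A' B' : J ⇒ Ob} {a : A ≈ A'} {b : B ≈ B'} (f : Hom A B) → f ≃ cast a b f
      ≃-cast f = ≈⇒≃ ≈.refl

      cast-cong : {A B A' B' A₂ B₂ A₂' B₂' : J ⇒ Ob} {a : A ≈ A₂} {b : B ≈ B₂} {a' : A' ≈ A₂'} {b' : B' ≈ B₂'}
                  {f : Hom A B} {f' : Hom A' B'} → f ≃ f' → cast a b f ≃ cast a' b' f'
      cast-cong (≈⇒≃ w) = ≈⇒≃ w

      idH-cong : {A A' : J ⇒ Ob} → A ≈ A' → idH A ≃ idH A'
      idH-cong a = ≈⇒≃ (∘-congˡ idm a)

      opaque
        unfolding _⊚_

        ⊚-cong : {A B D A' B' D' : J ⇒ Ob} {g : Hom B D} {g' : Hom B' D'} {f : Hom A B} {f' : Hom A' B'} →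
                 g ≃ g' → f ≃ f' → g ⊚ f ≃ g' ⊚ f'
        ⊚-cong (≈⇒≃ a) (≈⇒≃ b) = ≈⇒≃ (compose-cong a b)

        ⊚-identityˡ : {A B : J ⇒ Ob} (f : Hom A B) → idH B ⊚ f ≃ f
        ⊚-identityˡ f = ≈⇒≃ (≈.trans (compose-cong {q' = q} (∘-congˡ idm (≈.sym (arr-tgt f))) ≈.refl) (idˡ (arr f) q))
          where
            q : src ∘ (idm ∘ (tgt ∘ arr f)) ≈ tgt ∘ arr f
            q = ≈.trans assoc˘ (≈.trans (∘-congʳ src-idm _) identityˡ)

        ⊚-identityʳ : {A B : J ⇒ Ob} (f : Hom A B) → f ⊚ idH A ≃ f
        ⊚-identityʳ f = ≈⇒≃ (≈.trans (compose-cong {q' = q} ≈.refl (∘-congˡ idm (≈.sym (arr-src f)))) (idʳ (arr f) q))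
          where
            q : src ∘ arr f ≈ tgt ∘ (idm ∘ (src ∘ arr f))
            q = ≈.sym (≈.trans assoc˘ (≈.trans (∘-congʳ tgt-idm _) identityˡ))

        ⊚-assoc : {A B D E : J ⇒ Ob} (h : Hom D E) (g : Hom B D) (f : Hom A B) →
                  (h ⊚ g) ⊚ f ≃ h ⊚ (g ⊚ f)
        ⊚-assoc h g f = ≈⇒≃ (cassoc (arr h) (arr g) (arr f) _ _ _ _)

        compose≈⊚ : {A B D : J ⇒ Ob} (g : Hom B D) (f : Hom A B) (q : Compat (arr g) (arr f)) →
                    compose (arr g) (arr f) q ≈ arr (g ⊚ f)
        compose≈⊚ g f q = compose-cong ≈.refl ≈.refl

        ≋⇒⊚≈ : {A B D : J ⇒ Ob} (G : Hom B D) (F : Hom A B) {g f h : J ⇒ Mor} →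
               g ∙ f ≋ h → arr G ≈ g → arr F ≈ f → arr (G ⊚ F) ≈ h
        ≋⇒⊚≈ G F (q , r) a b = ≈.trans (compose-cong a b) r

        ⊚≈⇒≋ : {A B D : J ⇒ Ob} (G : Hom B D) (F : Hom A B) {g f h : J ⇒ Mor} →
               arr (G ⊚ F) ≈ h → arr G ≈ g → arr F ≈ f → g ∙ f ≋ h
        ⊚≈⇒≋ G F r a b = ≈.trans (∘-congˡ src (≈.sym a)) (≈.trans (arr-src G) (≈.trans (≈.sym (arr-tgt F)) (∘-congˡ tgt b))) ,
                          ≈.trans (compose-cong (≈.sym a) (≈.sym b)) r

        CompEq⇒≃ : {A B D B' : J ⇒ Ob} (G : Hom B D) (F : Hom A B) (G' : Hom B' D) (F' : Hom A B') →
                   CompEq (arr G) (arr F) (arr G') (arr F') → G ⊚ F ≃ G' ⊚ F'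
        CompEq⇒≃ G F G' F' (q , q' , r) = ≈⇒≃ (≈.trans (compose-cong ≈.refl ≈.refl) (≈.trans r (compose-cong ≈.refl ≈.refl)))

        ≃⇒CompEq : {A B D A' B' D' : J ⇒ Ob} (G : Hom B D) (F : Hom A B) (G' : Hom B' D') (F' : Hom A' B') →
                   G ⊚ F ≃ G' ⊚ F' → CompEq (arr G) (arr F) (arr G') (arr F')
        ≃⇒CompEq G F G' F' (≈⇒≃ r) =
          ≈.trans (arr-src G) (≈.sym (arr-tgt F)) , ≈.trans (arr-src G') (≈.sym (arr-tgt F')) ,
          ≈.trans (compose-cong ≈.refl ≈.refl) (≈.trans r (compose-cong ≈.refl ≈.refl))

        toIsInverse : {A B : J ⇒ Ob} (f : Hom A B) (g : Hom B A) → g ⊚ f ≃ idH A → f ⊚ g ≃ idH B →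
                      IsInverse (arr g) (arr f)
        toIsInverse f g l r = record
          { inv-src = ≈.trans (arr-src g) (≈.sym (arr-tgt f))
          ; inv-tgt = ≈.trans (arr-tgt g) (≈.sym (arr-src f))
          ; invˡ = _ , ≈.trans (≃⇒≈ l) (∘-congˡ idm (≈.sym (arr-src f)))
          ; invʳ = _ , ≈.trans (≃⇒≈ r) (∘-congˡ idm (≈.sym (arr-tgt f))) }

    module _ {J : Obj} where
      ≋-junction : {A B B' D : J ⇒ Ob} (G : Hom B' D) (F : Hom A B) {h : J ⇒ Mor} → arr G ∙ arr F ≋ h → B ≈ B'
      ≋-junction G F (q , _) = ≈.trans (≈.sym (arr-tgt F)) (≈.trans (≈.sym q) (arr-src G))

      ≋⇒≃ : {A B B' D A' D' : J ⇒ Ob} (G : Hom B' D) (F : Hom A B) (K : Hom A' D') (w : arr G ∙ arr F ≋ arr K) →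
            G ⊚ cast ≈.refl (≋-junction G F w) F ≃ K
      ≋⇒≃ G F K w = ≈⇒≃ (≋⇒⊚≈ G (cast ≈.refl (≋-junction G F w) F) w ≈.refl ≈.refl)

    ≋-∘ : ∀ {J J'} {g f h : J ⇒ Mor} (u : J' ⇒ J) → g ∙ f ≋ h → (g ∘ u) ∙ (f ∘ u) ≋ (h ∘ u)
    ≋-∘ u (q , r) = ≈.trans assoc˘ (≈.trans (∘-congʳ q u) assoc) , ≈.trans (≈.sym (compose-∘ {q = q})) (∘-congʳ r u)

    module _ {J : Obj} where
      record Iso {A B : J ⇒ Ob} (f : Hom A B) : Set (ℓ ⊔ e) where
        field
          inv  : Hom B A
          isoˡ : inv ⊚ f ≃ idH A
          isoʳ : f ⊚ inv ≃ idH B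

      opaque
        unfolding _⊚_

        IsIso⇒Iso : {A B : J ⇒ Ob} (f : Hom A B) → IsIso (arr f) → Iso f
        IsIso⇒Iso f (g , i) = record
          { inv  = hom g (≈.trans inv-src (arr-tgt f)) (≈.trans inv-tgt (arr-src f))
          ; isoˡ = ≈⇒≃ (≈.trans (compose-cong ≈.refl ≈.refl) (≈.trans (proj₂ invˡ) (∘-congˡ idm (arr-src f))))
          ; isoʳ = ≈⇒≃ (≈.trans (compose-cong ≈.refl ≈.refl) (≈.trans (proj₂ invʳ) (∘-congˡ idm (arr-tgt f)))) }
          where open IsInverse i

      Iso⇒IsInverse : {A B : J ⇒ Ob} {f : Hom A B} (i : Iso f) → IsInverse (arr (Iso.inv i)) (arr f)
      Iso⇒IsInverse {f = f} i = toIsInverse f (Iso.inv i) (Iso.isoˡ i) (Iso.isoʳ i)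

      open ≃-Reasoning

      inv-unique : {A B : J ⇒ Ob} {f : Hom A B} {g g' : Hom B A} →
                   g ⊚ f ≃ idH A → f ⊚ g' ≃ idH B → g ≃ g'
      inv-unique {A} {B} {f} {g} {g'} l r = begin
        g              ≃˘⟨ ⊚-identityʳ g ⟩
        g ⊚ idH B      ≃˘⟨ ⊚-cong ≃-refl r ⟩
        g ⊚ (f ⊚ g')   ≃˘⟨ ⊚-assoc g f g' ⟩
        (g ⊚ f) ⊚ g'   ≃⟨ ⊚-cong l ≃-refl ⟩
        idH A ⊚ g'     ≃⟨ ⊚-identityˡ g' ⟩
        g'             ∎

      inv-cong : {A B A' B' : J ⇒ Ob} {f : Hom A B} {f' : Hom A' B'} (i : Iso f) (i' : Iso f') →
                 f ≃ f' → Iso.inv i ≃ Iso.inv i'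
      inv-cong {A} {B} {A'} {B'} {f} {f'} i i' w =
        ≃-trans (≃-sym (inv-unique {f = f} {g = g} {g' = Iso.inv i} g⊚f (Iso.isoʳ i))) (≈⇒≃ ≈.refl)
        where
          g : Hom B A
          g = cast (≈.sym (≃-tgt w)) (≈.sym (≃-src w)) (Iso.inv i')
          g⊚f : g ⊚ f ≃ idH A
          g⊚f = begin
            g ⊚ f              ≃⟨ ⊚-cong (≈⇒≃ {f = g} {g = Iso.inv i'} ≈.refl) w ⟩
            Iso.inv i' ⊚ f'    ≃⟨ Iso.isoˡ i' ⟩
            idH A'             ≃˘⟨ idH-cong (≃-src w) ⟩
            idH A              ∎

      Iso-idH : (A : J ⇒ Ob) → Iso (idH A)
      Iso-idH A = record { inv = idH A ; isoˡ = ⊚-identityˡ (idH A) ; isoʳ = ⊚-identityˡ (idH A) }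

      Iso-⊚ : {A B D : J ⇒ Ob} {g : Hom B D} {f : Hom A B} → Iso g → Iso f → Iso (g ⊚ f)
      Iso-⊚ {A} {B} {D} {g} {f} ig if = record
        { inv  = f⁻¹ ⊚ g⁻¹
        ; isoˡ = begin
            (f⁻¹ ⊚ g⁻¹) ⊚ (g ⊚ f)   ≃⟨ ⊚-assoc f⁻¹ g⁻¹ (g ⊚ f) ⟩
            f⁻¹ ⊚ (g⁻¹ ⊚ (g ⊚ f))   ≃˘⟨ ⊚-cong ≃-refl (⊚-assoc g⁻¹ g f) ⟩
            f⁻¹ ⊚ ((g⁻¹ ⊚ g) ⊚ f)   ≃⟨ ⊚-cong ≃-refl (⊚-cong (Iso.isoˡ ig) ≃-refl) ⟩
            f⁻¹ ⊚ (idH B ⊚ f)       ≃⟨ ⊚-cong ≃-refl (⊚-identityˡ f) ⟩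
            f⁻¹ ⊚ f                 ≃⟨ Iso.isoˡ if ⟩
            idH A                   ∎
        ; isoʳ = begin
            (g ⊚ f) ⊚ (f⁻¹ ⊚ g⁻¹)   ≃⟨ ⊚-assoc g f (f⁻¹ ⊚ g⁻¹) ⟩
            g ⊚ (f ⊚ (f⁻¹ ⊚ g⁻¹))   ≃˘⟨ ⊚-cong ≃-refl (⊚-assoc f f⁻¹ g⁻¹) ⟩
            g ⊚ ((f ⊚ f⁻¹) ⊚ g⁻¹)   ≃⟨ ⊚-cong ≃-refl (⊚-cong (Iso.isoʳ if) ≃-refl) ⟩
            g ⊚ (idH B ⊚ g⁻¹)       ≃⟨ ⊚-cong ≃-refl (⊚-identityˡ g⁻¹) ⟩
            g ⊚ g⁻¹                 ≃⟨ Iso.isoʳ ig ⟩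
            idH D                   ∎ }
        where
          f⁻¹ = Iso.inv if
          g⁻¹ = Iso.inv ig

      Iso-cast : {A B A' B' : J ⇒ Ob} {f : Hom A B} (a : A ≈ A') (b : B ≈ B') → Iso f → Iso (cast a b f)
      Iso-cast {f = f} a b i = record
        { inv  = cast b a (Iso.inv i)
        ; isoˡ = ≃-trans (⊚-cong (≈⇒≃ {f = cast b a (Iso.inv i)} {g = Iso.inv i} ≈.refl) (≈⇒≃ {f = cast a b f} {g = f} ≈.refl))
                         (≃-trans (Iso.isoˡ i) (idH-cong a))
        ; isoʳ = ≃-trans (⊚-cong (≈⇒≃ {f = cast a b f} {g = f} ≈.refl) (≈⇒≃ {f = cast b a (Iso.inv i)} {g = Iso.inv i} ≈.refl))
                         (≃-trans (Iso.isoʳ i) (idH-cong b)) }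

      cancelʳ : {A B D D' : J ⇒ Ob} {g : Hom B D} {g' : Hom B D'} {w : Hom A B} → Iso w →
                g ⊚ w ≃ g' ⊚ w → g ≃ g'
      cancelʳ {B = B} {g = g} {g'} {w} iw e = begin
        g                ≃˘⟨ ⊚-identityʳ g ⟩
        g ⊚ idH B        ≃˘⟨ ⊚-cong ≃-refl (Iso.isoʳ iw) ⟩
        g ⊚ (w ⊚ w⁻¹)    ≃˘⟨ ⊚-assoc g w w⁻¹ ⟩
        (g ⊚ w) ⊚ w⁻¹    ≃⟨ ⊚-cong e ≃-refl ⟩
        (g' ⊚ w) ⊚ w⁻¹   ≃⟨ ⊚-assoc g' w w⁻¹ ⟩
        g' ⊚ (w ⊚ w⁻¹)   ≃⟨ ⊚-cong ≃-refl (Iso.isoʳ iw) ⟩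
        g' ⊚ idH B       ≃⟨ ⊚-identityʳ g' ⟩
        g'               ∎
        where
          w⁻¹ = Iso.inv iw

    module _ {J J' : Obj} (u : J' ⇒ J) where
      reindex : {A B : J ⇒ Ob} → Hom A B → Hom (A ∘ u) (B ∘ u)
      reindex f = hom (arr f ∘ u) (≈.trans assoc˘ (∘-congʳ (arr-src f) u)) (≈.trans assoc˘ (∘-congʳ (arr-tgt f) u))

      reindex-cong : {A B A' B' : J ⇒ Ob} {f : Hom A B} {f' : Hom A' B'} → f ≃ f' → reindex f ≃ reindex f'
      reindex-cong (≈⇒≃ a) = ≈⇒≃ (∘-congʳ a u)

      reindex-idH : (A : J ⇒ Ob) → reindex (idH A) ≃ idH (A ∘ u)
      reindex-idH A = ≈⇒≃ assoc

      opaque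
        unfolding _⊚_
        reindex-⊚ : {A B D : J ⇒ Ob} (g : Hom B D) (f : Hom A B) → reindex (g ⊚ f) ≃ reindex g ⊚ reindex f
        reindex-⊚ g f = ≈⇒≃ (compose-∘ {g = arr g} {f = arr f} {q = ≈.trans (arr-src g) (≈.sym (arr-tgt f))} {u = u})

      Iso-reindex : {A B : J ⇒ Ob} {f : Hom A B} → Iso f → Iso (reindex f)
      Iso-reindex {A} {B} {f} i = record
        { inv  = reindex (Iso.inv i)
        ; isoˡ = ≃-trans (≃-sym (reindex-⊚ (Iso.inv i) f)) (≃-trans (reindex-cong (Iso.isoˡ i)) (reindex-idH A))
        ; isoʳ = ≃-trans (≃-sym (reindex-⊚ f (Iso.inv i))) (≃-trans (reindex-cong (Iso.isoʳ i)) (reindex-idH B)) }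

module Construction {o ℓ e ℓm} {C : Category o ℓ e} (fc : FinitelyComplete C) {p : ℕ∞}
    (Rel : Setup.CubicalCategory C fc p)
    (GI : Setup.Cubes.GoodIsos C fc Rel ℓm)
    (T : Setup.Cubes.WithM.StableTerminals C fc Rel GI)
    (P : Setup.Cubes.WithM.StableProducts C fc Rel GI)
    (Ex : Setup.Cubes.WithM.WithProducts.StableExponentials C fc Rel GI P) where
  open InternalArrows fc
  open Cubes Rel
  open CubicalCategory Rel
  open WithM GI
  open GoodIsos GI
  open StableTerminals T
  open StableProducts P
  open WithProducts P
  open StableExponentials Ex
  open module ArrowsOf {X : ICat} = Arrows X

  HomAt : (L : Lvl p) {J : Obj} → J ⇒ R.Ob L → J ⇒ R.Ob L → Set (ℓ ⊔ e)
  HomAt L = Hom {X = cat L}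

  -- Cartesian closed structure of a single level

  module _ (L : Lvl p) {J : Obj} where
    private
      Ob₀ = J ⇒ R.Ob L
      Hm = HomAt L {J}

    prod₀ : Ob₀ → Ob₀ → Ob₀
    prod₀ A B = prod L ∘ ⟨ A , B ⟩

    exp₀ : Ob₀ → Ob₀ → Ob₀
    exp₀ A B = exp L ∘ ⟨ A , B ⟩

    one₀ : Ob₀
    one₀ = one L ∘ !

    prod₀-cong : ∀ {A B A' B'} → A ≈ A' → B ≈ B' → prod₀ A B ≈ prod₀ A' B'
    prod₀-cong a b = ∘-congˡ (prod L) (⟨⟩-cong a b)

    exp₀-cong : ∀ {A B A' B'} → A ≈ A' → B ≈ B' → exp₀ A B ≈ exp₀ A' B'
    exp₀-cong a b = ∘-congˡ (exp L) (⟨⟩-cong a b)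

    fstH : (A B : Ob₀) → Hm (prod₀ A B) A
    fstH A B = hom (fst L ∘ ⟨ A , B ⟩) (≈.trans assoc˘ (∘-congʳ (fst-src L) _))
                   (≈.trans assoc˘ (≈.trans (∘-congʳ (fst-tgt L) _) π₁-β))

    sndH : (A B : Ob₀) → Hm (prod₀ A B) B
    sndH A B = hom (snd L ∘ ⟨ A , B ⟩) (≈.trans assoc˘ (∘-congʳ (snd-src L) _))
                   (≈.trans assoc˘ (≈.trans (∘-congʳ (snd-tgt L) _) π₂-β))

    evalH : (A B : Ob₀) → Hm (prod₀ (exp₀ A B) A) B
    evalH A B = hom (eval L ∘ ⟨ A , B ⟩)
      (≈.trans assoc˘ (≈.trans (∘-congʳ (eval-src L) _)
        (≈.trans assoc (∘-congˡ (prod L) (≈.trans ⟨⟩∘ (⟨⟩-cong ≈.refl π₁-β))))))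
      (≈.trans assoc˘ (≈.trans (∘-congʳ (eval-tgt L) _) π₂-β))

    termH : (A : Ob₀) → Hm A one₀
    termH A = hom (term L A) (term-src L A) (term-tgt L A)

    termH-unique : ∀ {A} (f : Hm A one₀) → f ≃ termH A
    termH-unique f = ≈⇒≃ (term-unique L _ (arr f) (arr-src f) (arr-tgt f))

    fstH-cong : ∀ {A B A' B'} → A ≈ A' → B ≈ B' → fstH A B ≃ fstH A' B'
    fstH-cong a b = ≈⇒≃ (∘-congˡ (fst L) (⟨⟩-cong a b))

    sndH-cong : ∀ {A B A' B'} → A ≈ A' → B ≈ B' → sndH A B ≃ sndH A' B'
    sndH-cong a b = ≈⇒≃ (∘-congˡ (snd L) (⟨⟩-cong a b))

    evalH-cong : ∀ {A B A' B'} → A ≈ A' → B ≈ B' → evalH A B ≃ evalH A' B'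
    evalH-cong a b = ≈⇒≃ (∘-congˡ (eval L) (⟨⟩-cong a b))

    opaque
      pairH : ∀ {Z A B} → Hm Z A → Hm Z B → Hm Z (prod₀ A B)
      pairH f g = hom (pair L (arr f) (arr g) (≈.trans (arr-src f) (≈.sym (arr-src g))))
                      (≈.trans (pair-src L _ _ _) (arr-src f))
                      (≈.trans (pair-tgt L _ _ _) (prod₀-cong (arr-tgt f) (arr-tgt g)))

    opaque
      unfolding pairH

      pairH-fst : ∀ {Z A B} (f : Hm Z A) (g : Hm Z B) → fstH A B ⊚ pairH f g ≃ f
      pairH-fst f g = ≈⇒≃ (≋⇒⊚≈ (fstH _ _) (pairH f g) (pair-fst L _ _ _)
                             (∘-congˡ (fst L) (⟨⟩-cong (≈.sym (arr-tgt f)) (≈.sym (arr-tgt g)))) ≈.refl)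

      pairH-snd : ∀ {Z A B} (f : Hm Z A) (g : Hm Z B) → sndH A B ⊚ pairH f g ≃ g
      pairH-snd f g = ≈⇒≃ (≋⇒⊚≈ (sndH _ _) (pairH f g) (pair-snd L _ _ _)
                             (∘-congˡ (snd L) (⟨⟩-cong (≈.sym (arr-tgt f)) (≈.sym (arr-tgt g)))) ≈.refl)

      pairH-unique : ∀ {Z A B} {f : Hm Z A} {g : Hm Z B} (h : Hm Z (prod₀ A B)) →
                     fstH A B ⊚ h ≃ f → sndH A B ⊚ h ≃ g → h ≃ pairH f g
      pairH-unique {f = f} {g} h w₁ w₂ = ≈⇒≃ (pair-unique L (arr f) (arr g) _ (arr h)
        (≈.trans (arr-src h) (≈.sym (arr-src f)))
        (≈.trans (arr-tgt h) (prod₀-cong (≈.sym (arr-tgt f)) (≈.sym (arr-tgt g))))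
        (⊚≈⇒≋ (fstH _ _) h (≃⇒≈ w₁) (∘-congˡ (fst L) (⟨⟩-cong (≈.sym (arr-tgt f)) (≈.sym (arr-tgt g)))) ≈.refl)
        (⊚≈⇒≋ (sndH _ _) h (≃⇒≈ w₂) (∘-congˡ (snd L) (⟨⟩-cong (≈.sym (arr-tgt f)) (≈.sym (arr-tgt g)))) ≈.refl))

    open ≃-Reasoning

    pairH-ext : ∀ {Z A B} (h k : Hm Z (prod₀ A B)) →
                fstH A B ⊚ h ≃ fstH A B ⊚ k → sndH A B ⊚ h ≃ sndH A B ⊚ k → h ≃ k
    pairH-ext h k w₁ w₂ = ≃-trans (pairH-unique h ≃-refl ≃-refl) (≃-sym (pairH-unique k (≃-sym w₁) (≃-sym w₂)))

    pairH-cong : ∀ {Z A B Z' A' B'} {f : Hm Z A} {f' : Hm Z' A'} {g : Hm Z B} {g' : Hm Z' B'} →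
                 f ≃ f' → g ≃ g' → pairH f g ≃ pairH f' g'
    pairH-cong {f = f} {f'} {g} {g'} a b = ≃-trans (≈⇒≃ ≈.refl) (pairH-unique c
      (≃-trans (⊚-cong (fstH-cong (≈.sym (≃-tgt a)) (≈.sym (≃-tgt b))) (cast-≃ (pairH f g))) (≃-trans (pairH-fst f g) a))
      (≃-trans (⊚-cong (sndH-cong (≈.sym (≃-tgt a)) (≈.sym (≃-tgt b))) (cast-≃ (pairH f g))) (≃-trans (pairH-snd f g) b)))
      where
        c = cast (≃-src a) (prod₀-cong (≃-tgt a) (≃-tgt b)) (pairH f g)

    pairH-⊚ : ∀ {W Z A B} (f : Hm Z A) (g : Hm Z B) (k : Hm W Z) → pairH f g ⊚ k ≃ pairH (f ⊚ k) (g ⊚ k)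
    pairH-⊚ {A = A} {B} f g k = pairH-unique (pairH f g ⊚ k)
      (≃-trans (≃-sym (⊚-assoc (fstH A B) (pairH f g) k)) (⊚-cong (pairH-fst f g) ≃-refl))
      (≃-trans (≃-sym (⊚-assoc (sndH A B) (pairH f g) k)) (⊚-cong (pairH-snd f g) ≃-refl))

    infixr 8 _×H_
    opaque
      _×H_ : ∀ {A A' B B'} → Hm A A' → Hm B B' → Hm (prod₀ A B) (prod₀ A' B')
      _×H_ {A} {A'} {B} {B'} a b = pairH (a ⊚ fstH A B) (b ⊚ sndH A B)

    opaque
      unfolding _×H_

      ×H-unique : ∀ {A A' B B'} {a : Hm A A'} {b : Hm B B'} (h : Hm (prod₀ A B) (prod₀ A' B')) →
                  fstH A' B' ⊚ h ≃ a ⊚ fstH A B → sndH A' B' ⊚ h ≃ b ⊚ sndH A B → h ≃ a ×H b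
      ×H-unique = pairH-unique

      ×H-fst : ∀ {A A' B B'} (a : Hm A A') (b : Hm B B') → fstH A' B' ⊚ (a ×H b) ≃ a ⊚ fstH A B
      ×H-fst a b = pairH-fst _ _

      ×H-snd : ∀ {A A' B B'} (a : Hm A A') (b : Hm B B') → sndH A' B' ⊚ (a ×H b) ≃ b ⊚ sndH A B
      ×H-snd a b = pairH-snd _ _

      ×H-cong : ∀ {A A' B B' A₂ A₂' B₂ B₂'} {a : Hm A A'} {a' : Hm A₂ A₂'} {b : Hm B B'} {b' : Hm B₂ B₂'} →
                a ≃ a' → b ≃ b' → a ×H b ≃ a' ×H b'
      ×H-cong x y = pairH-cong (⊚-cong x (fstH-cong (≃-src x) (≃-src y))) (⊚-cong y (sndH-cong (≃-src x) (≃-src y)))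

      ×H-⊚-pairH : ∀ {Z A A' B B'} (a : Hm A A') (b : Hm B B') (f : Hm Z A) (g : Hm Z B) →
                   (a ×H b) ⊚ pairH f g ≃ pairH (a ⊚ f) (b ⊚ g)
      ×H-⊚-pairH {A = A} {B = B} a b f g = ≃-trans (pairH-⊚ _ _ (pairH f g)) (pairH-cong
        (≃-trans (⊚-assoc a (fstH A B) (pairH f g)) (⊚-cong ≃-refl (pairH-fst f g)))
        (≃-trans (⊚-assoc b (sndH A B) (pairH f g)) (⊚-cong ≃-refl (pairH-snd f g))))

      ×H-⊚ : ∀ {A A' A'' B B' B''} (a' : Hm A' A'') (b' : Hm B' B'') (a : Hm A A') (b : Hm B B') →
             (a' ×H b') ⊚ (a ×H b) ≃ (a' ⊚ a) ×H (b' ⊚ b)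
      ×H-⊚ {A} {B = B} a' b' a b = ≃-trans (×H-⊚-pairH a' b' _ _)
        (pairH-cong (≃-sym (⊚-assoc a' a (fstH A B))) (≃-sym (⊚-assoc b' b (sndH A B))))

      ×H-idH : (A B : Ob₀) → idH A ×H idH B ≃ idH (prod₀ A B)
      ×H-idH A B = ≃-sym (pairH-unique (idH (prod₀ A B))
        (≃-trans (⊚-identityʳ (fstH A B)) (≃-sym (⊚-identityˡ (fstH A B))))
        (≃-trans (⊚-identityʳ (sndH A B)) (≃-sym (⊚-identityˡ (sndH A B)))))

    ×H-interchange : ∀ {Z Z' A A'} (g : Hm Z Z') (a : Hm A' A) →
                     (g ×H idH A) ⊚ (idH Z ×H a) ≃ (idH Z' ×H a) ⊚ (g ×H idH A')
    ×H-interchange g a = ≃-trans (×H-⊚ g (idH _) (idH _) a)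
      (≃-trans (×H-cong (⊚-identityʳ g) (⊚-identityˡ a))
      (≃-sym (≃-trans (×H-⊚ (idH _) a g (idH _)) (×H-cong (⊚-identityˡ g) (⊚-identityʳ a)))))

    Iso-×H : ∀ {A A' B B'} {a : Hm A A'} {b : Hm B B'} → Iso a → Iso b → Iso (a ×H b)
    Iso-×H {A} {A'} {B} {B'} {a} {b} ia ib = record
      { inv  = Iso.inv ia ×H Iso.inv ib
      ; isoˡ = ≃-trans (×H-⊚ (Iso.inv ia) (Iso.inv ib) a b) (≃-trans (×H-cong (Iso.isoˡ ia) (Iso.isoˡ ib)) (×H-idH A B))
      ; isoʳ = ≃-trans (×H-⊚ a b (Iso.inv ia) (Iso.inv ib)) (≃-trans (×H-cong (Iso.isoʳ ia) (Iso.isoʳ ib)) (×H-idH A' B')) }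

    -- The axioms speak about product morphisms through IsProdMor; this
    -- identifies them with _×H_.
    endpoints : ∀ {A B} (a : Hm A B) → Hm (R.src L ∘ arr a) (R.tgt L ∘ arr a)
    endpoints a = hom (arr a) ≈.refl ≈.refl

    ×H-isProdMor : ∀ {A A' B B'} (a : Hm A A') (b : Hm B B') → ProdMor L (arr a) (arr b) (arr (a ×H b))
    ×H-isProdMor {A} {A'} {B} {B'} a b =
      arr-src ab , arr-tgt ab ,
      ≃⇒CompEq (fstH _ _) ab (endpoints a) (fstH _ _) (begin
        fstH tA tB ⊚ ab           ≃⟨ ⊚-cong (fstH-cong (arr-tgt a) (arr-tgt b)) (cast-≃ (a ×H b)) ⟩
        fstH A' B' ⊚ (a ×H b)     ≃⟨ ×H-fst a b ⟩
        a ⊚ fstH A B              ≃⟨ ⊚-cong (≈⇒≃ {f = a} {g = endpoints a} ≈.refl) (fstH-cong (≈.sym (arr-src a)) (≈.sym (arr-src b))) ⟩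
        endpoints a ⊚ fstH sA sB  ∎) ,
      ≃⇒CompEq (sndH _ _) ab (endpoints b) (sndH _ _) (begin
        sndH tA tB ⊚ ab           ≃⟨ ⊚-cong (sndH-cong (arr-tgt a) (arr-tgt b)) (cast-≃ (a ×H b)) ⟩
        sndH A' B' ⊚ (a ×H b)     ≃⟨ ×H-snd a b ⟩
        b ⊚ sndH A B              ≃⟨ ⊚-cong (≈⇒≃ {f = b} {g = endpoints b} ≈.refl) (sndH-cong (≈.sym (arr-src a)) (≈.sym (arr-src b))) ⟩
        endpoints b ⊚ sndH sA sB  ∎)
      where
        sA = R.src L ∘ arr a
        sB = R.src L ∘ arr b
        tA = R.tgt L ∘ arr a
        tB = R.tgt L ∘ arr b
        ab : Hm (prod₀ sA sB) (prod₀ tA tB)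
        ab = cast (prod₀-cong (≈.sym (arr-src a)) (≈.sym (arr-src b))) (prod₀-cong (≈.sym (arr-tgt a)) (≈.sym (arr-tgt b))) (a ×H b)

    isProdMor⇒≈×H : ∀ {A A' B B'} (a : Hm A A') (b : Hm B B') {m : J ⇒ R.Mor L} →
                    ProdMor L (arr a) (arr b) m → m ≈ arr (a ×H b)
    isProdMor⇒≈×H {A} {A'} {B} {B'} a b {m} (s , t , c₁ , c₂) = ≃⇒≈ (×H-unique mh
      (begin
        fstH A' B' ⊚ mh           ≃˘⟨ ⊚-cong (fstH-cong (arr-tgt a) (arr-tgt b)) (≈⇒≃ {f = mh'} {g = mh} ≈.refl) ⟩
        fstH tA tB ⊚ mh'          ≃⟨ CompEq⇒≃ (fstH tA tB) mh' (endpoints a) (fstH sA sB) c₁ ⟩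
        endpoints a ⊚ fstH sA sB
          ≃˘⟨ ⊚-cong (≈⇒≃ {f = a} {g = endpoints a} ≈.refl) (fstH-cong (≈.sym (arr-src a)) (≈.sym (arr-src b))) ⟩
        a ⊚ fstH A B              ∎)
      (begin
        sndH A' B' ⊚ mh           ≃˘⟨ ⊚-cong (sndH-cong (arr-tgt a) (arr-tgt b)) (≈⇒≃ {f = mh'} {g = mh} ≈.refl) ⟩
        sndH tA tB ⊚ mh'          ≃⟨ CompEq⇒≃ (sndH tA tB) mh' (endpoints b) (sndH sA sB) c₂ ⟩
        endpoints b ⊚ sndH sA sB
          ≃˘⟨ ⊚-cong (≈⇒≃ {f = b} {g = endpoints b} ≈.refl) (sndH-cong (≈.sym (arr-src a)) (≈.sym (arr-src b))) ⟩
        b ⊚ sndH A B              ∎))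
      where
        sA = R.src L ∘ arr a
        sB = R.src L ∘ arr b
        tA = R.tgt L ∘ arr a
        tB = R.tgt L ∘ arr b
        mh : Hm (prod₀ A B) (prod₀ A' B')
        mh = hom m (≈.trans s (prod₀-cong (arr-src a) (arr-src b))) (≈.trans t (prod₀-cong (arr-tgt a) (arr-tgt b)))
        mh' : Hm (prod₀ sA sB) (prod₀ tA tB)
        mh' = hom m s t

    opaque
      curryH : ∀ {Z A B} → Hm (prod₀ Z A) B → Hm Z (exp₀ A B)
      curryH {Z} {A} {B} f = hom (curry L Z A B (arr f) (arr-src f) (arr-tgt f)) (curry-src L _ _ _ _ _ _) (curry-tgt L _ _ _ _ _ _)

    opaque
      unfolding curryH

      curryH-β : ∀ {Z A B} (f : Hm (prod₀ Z A) B) → evalH A B ⊚ (curryH f ×H idH A) ≃ f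
      curryH-β {Z} {A} {B} f with curry-β L Z A B (arr f) (arr-src f) (arr-tgt f)
      ... | m , m-isProd , eval∙m≋f =
        ≈⇒≃ (≋⇒⊚≈ (evalH A B) (curryH f ×H idH A) eval∙m≋f ≈.refl (≈.sym (isProdMor⇒≈×H (curryH f) (idH A) m-isProd)))

      curryH-unique : ∀ {Z A B} {f : Hm (prod₀ Z A) B} (g : Hm Z (exp₀ A B)) →
                      evalH A B ⊚ (g ×H idH A) ≃ f → g ≃ curryH f
      curryH-unique {Z} {A} {B} {f} g w = ≈⇒≃ (curry-unique L Z A B (arr f) (arr-src f) (arr-tgt f) (arr g) (arr-src g) (arr-tgt g)
        (arr (g ×H idH A) , ×H-isProdMor g (idH A) , ⊚≈⇒≋ (evalH A B) (g ×H idH A) (≃⇒≈ w) ≈.refl ≈.refl))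

    curryH-ext : ∀ {Z A B} (g g' : Hm Z (exp₀ A B)) →
                 evalH A B ⊚ (g ×H idH A) ≃ evalH A B ⊚ (g' ×H idH A) → g ≃ g'
    curryH-ext g g' w = ≃-trans (curryH-unique g w) (≃-sym (curryH-unique g' ≃-refl))

    curryH-cong : ∀ {Z A B Z' A' B'} {f : Hm (prod₀ Z A) B} {f' : Hm (prod₀ Z' A') B'} →
                  Z ≈ Z' → A ≈ A' → B ≈ B' → f ≃ f' → curryH f ≃ curryH f'
    curryH-cong {Z} {A} {B} {Z'} {A'} {B'} {f} {f'} z a b w = ≃-trans (≈⇒≃ ≈.refl) (curryH-unique c (begin
      evalH A' B' ⊚ (c ×H idH A')          ≃˘⟨ ⊚-cong (evalH-cong a b) (×H-cong (≃-cast (curryH f)) (idH-cong a)) ⟩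
      evalH A B ⊚ (curryH f ×H idH A)      ≃⟨ curryH-β f ⟩
      f                                    ≃⟨ w ⟩
      f'                                   ∎))
      where
        c = cast z (exp₀-cong a b) (curryH f)

    opaque
      expH : ∀ {A A' B B'} → Hm A' A → Hm B B' → Hm (exp₀ A B) (exp₀ A' B')
      expH {A} {A'} {B} {B'} a b = curryH (b ⊚ (evalH A B ⊚ (idH (exp₀ A B) ×H a)))

    opaque
      unfolding expH

      expH-β : ∀ {A A' B B'} (a : Hm A' A) (b : Hm B B') →
               evalH A' B' ⊚ (expH a b ×H idH A') ≃ b ⊚ (evalH A B ⊚ (idH (exp₀ A B) ×H a))
      expH-β a b = curryH-β _

      expH-unique : ∀ {A A' B B'} {a : Hm A' A} {b : Hm B B'} (g : Hm (exp₀ A B) (exp₀ A' B')) →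
                    evalH A' B' ⊚ (g ×H idH A') ≃ b ⊚ (evalH A B ⊚ (idH (exp₀ A B) ×H a)) → g ≃ expH a b
      expH-unique = curryH-unique

    expH-cong : ∀ {A A' B B' A₂ A₂' B₂ B₂'} {a : Hm A' A} {b : Hm B B'} {a' : Hm A₂' A₂} {b' : Hm B₂ B₂'} →
                a ≃ a' → b ≃ b' → expH a b ≃ expH a' b'
    expH-cong {A} {A'} {B} {B'} {A₂} {A₂'} {B₂} {B₂'} {a} {b} {a'} {b'} wa wb = ≃-trans (≈⇒≃ ≈.refl) (expH-unique c (begin
      evalH A₂' B₂' ⊚ (c ×H idH A₂')
        ≃˘⟨ ⊚-cong (evalH-cong (≃-src wa) (≃-tgt wb)) (×H-cong (≃-cast (expH a b)) (idH-cong (≃-src wa))) ⟩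
      evalH A' B' ⊚ (expH a b ×H idH A')
        ≃⟨ expH-β a b ⟩
      b ⊚ (evalH A B ⊚ (idH (exp₀ A B) ×H a))
        ≃⟨ ⊚-cong wb (⊚-cong (evalH-cong (≃-tgt wa) (≃-src wb)) (×H-cong (idH-cong (exp₀-cong (≃-tgt wa) (≃-src wb))) wa)) ⟩
      b' ⊚ (evalH A₂ B₂ ⊚ (idH (exp₀ A₂ B₂) ×H a'))
        ∎))
      where
        c = cast (exp₀-cong (≃-tgt wa) (≃-src wb)) (exp₀-cong (≃-src wa) (≃-tgt wb)) (expH a b)

    expH-idH : (A B : Ob₀) → expH (idH A) (idH B) ≃ idH (exp₀ A B)
    expH-idH A B = ≃-sym (expH-unique (idH (exp₀ A B)) (begin
      evalH A B ⊚ (idH (exp₀ A B) ×H idH A)              ≃⟨ ⊚-cong ≃-refl (×H-idH (exp₀ A B) A) ⟩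
      evalH A B ⊚ idH (prod₀ (exp₀ A B) A)               ≃⟨ ⊚-identityʳ (evalH A B) ⟩
      evalH A B                                          ≃˘⟨ ⊚-identityˡ (evalH A B) ⟩
      idH B ⊚ evalH A B
        ≃˘⟨ ⊚-cong ≃-refl (≃-trans (⊚-cong ≃-refl (×H-idH (exp₀ A B) A)) (⊚-identityʳ (evalH A B))) ⟩
      idH B ⊚ (evalH A B ⊚ (idH (exp₀ A B) ×H idH A))    ∎))

    expH-⊚ : ∀ {A A' A'' B B' B''} (a : Hm A'' A') (b : Hm B' B'') (a' : Hm A' A) (b' : Hm B B') →
             expH a b ⊚ expH a' b' ≃ expH (a' ⊚ a) (b ⊚ b')
    expH-⊚ {A} {A'} {A''} {B} {B'} {B''} a b a' b' = expH-unique (expH a b ⊚ expH a' b') (begin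
      ev'' ⊚ ((expH a b ⊚ expH a' b') ×H idH A'')
        ≃˘⟨ ⊚-cong ≃-refl (≃-trans (×H-⊚ (expH a b) (idH A'') (expH a' b') (idH A''))
                                                (×H-cong ≃-refl (⊚-identityˡ (idH A'')))) ⟩
      ev'' ⊚ ((expH a b ×H idH A'') ⊚ (expH a' b' ×H idH A''))
        ≃˘⟨ ⊚-assoc ev'' _ _ ⟩
      (ev'' ⊚ (expH a b ×H idH A'')) ⊚ (expH a' b' ×H idH A'')
        ≃⟨ ⊚-cong (expH-β a b) ≃-refl ⟩
      (b ⊚ (ev' ⊚ (idH E' ×H a))) ⊚ (expH a' b' ×H idH A'')
        ≃⟨ ≃-trans (⊚-assoc b _ _) (⊚-cong ≃-refl (⊚-assoc ev' _ _)) ⟩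
      b ⊚ (ev' ⊚ ((idH E' ×H a) ⊚ (expH a' b' ×H idH A'')))
        ≃˘⟨ ⊚-cong ≃-refl (⊚-cong ≃-refl (×H-interchange (expH a' b') a)) ⟩
      b ⊚ (ev' ⊚ ((expH a' b' ×H idH A') ⊚ (idH E ×H a)))
        ≃˘⟨ ⊚-cong ≃-refl (⊚-assoc ev' _ _) ⟩
      b ⊚ ((ev' ⊚ (expH a' b' ×H idH A')) ⊚ (idH E ×H a))
        ≃⟨ ⊚-cong ≃-refl (⊚-cong (expH-β a' b') ≃-refl) ⟩
      b ⊚ ((b' ⊚ (ev ⊚ (idH E ×H a'))) ⊚ (idH E ×H a))
        ≃⟨ ⊚-cong ≃-refl (≃-trans (⊚-assoc b' _ _) (⊚-cong ≃-refl (⊚-assoc ev _ _))) ⟩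
      b ⊚ (b' ⊚ (ev ⊚ ((idH E ×H a') ⊚ (idH E ×H a))))
        ≃˘⟨ ⊚-assoc b b' _ ⟩
      (b ⊚ b') ⊚ (ev ⊚ ((idH E ×H a') ⊚ (idH E ×H a)))
        ≃⟨ ⊚-cong ≃-refl (⊚-cong ≃-refl
             (≃-trans (×H-⊚ (idH E) a' (idH E) a) (×H-cong (⊚-identityˡ (idH E)) ≃-refl))) ⟩
      (b ⊚ b') ⊚ (ev ⊚ (idH E ×H (a' ⊚ a)))
        ∎)
      where
        E = exp₀ A B
        E' = exp₀ A' B'
        ev = evalH A B
        ev' = evalH A' B'
        ev'' = evalH A'' B''

    M-×H : ∀ {A A' B B'} (a : Hm A A') (b : Hm B B') → M L (arr a) → M L (arr b) → M L (arr (a ×H b))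
    M-×H a b ma mb = M-prod L _ _ _ ma mb (×H-isProdMor a b)

    M⇒Iso : ∀ {A B} (f : Hm A B) → M L (arr f) → Iso f
    M⇒Iso f mf = IsIso⇒Iso f (M-iso mf)

    M-Iso-inv : ∀ {A B} {f : Hm A B} (i : Iso f) → M L (arr f) → M L (arr (Iso.inv i))
    M-Iso-inv i mf = M-inv mf (Iso⇒IsInverse i)

    M-⊚ : ∀ {A B D} (g : Hm B D) (f : Hm A B) → M L (arr g) → M L (arr f) → M L (arr (g ⊚ f))
    M-⊚ g f mg mf = M-comp mg mf (⊚≈⇒≋ g f ≈.refl ≈.refl ≈.refl)

    M-expH : ∀ {A A' B B'} (a : Hm A' A) (b : Hm B B') → M L (arr a) → M L (arr b) → M L (arr (expH a b))
    M-expH {A} {A'} {B} {B'} a b ma mb = M-exp L (arr a) (arr b) (arr E) ma mb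
        (≈.trans (arr-src E) (exp₀-cong (≈.sym (arr-tgt a)) (≈.sym (arr-src b))))
        (≈.trans (arr-tgt E) (exp₀-cong (≈.sym (arr-src a)) (≈.sym (arr-tgt b))))
        (arr (E ×H idH sa) , arr (idH (R.src L ∘ arr E) ×H a) , arr (endpoints b ⊚ evalH ta sb) ,
         ×H-isProdMor E (idH sa) , ×H-isProdMor (idH (R.src L ∘ arr E)) a ,
         ⊚≈⇒≋ (endpoints b) (evalH ta sb) ≈.refl ≈.refl ≈.refl ,
         ≃⇒CompEq (evalH sa tb) E×sa (endpoints b ⊚ evalH ta sb) E×a (begin
           evalH sa tb ⊚ E×sa
             ≃⟨ ⊚-cong (evalH-cong (arr-src a) (arr-tgt b)) (≃-trans (cast-≃ (E ×H idH sa)) (×H-cong ≃-refl (idH-cong (arr-src a)))) ⟩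
           evalH A' B' ⊚ (E ×H idH A')                  ≃⟨ expH-β a b ⟩
           b ⊚ (evalH A B ⊚ (idH (exp₀ A B) ×H a))      ≃˘⟨ ⊚-assoc b (evalH A B) _ ⟩
           (b ⊚ evalH A B) ⊚ (idH (exp₀ A B) ×H a)
             ≃⟨ ⊚-cong (⊚-cong (≈⇒≃ {f = b} {g = endpoints b} ≈.refl) (evalH-cong (≈.sym (arr-tgt a)) (≈.sym (arr-src b))))
                       (≃-trans (×H-cong (idH-cong (≈.sym (arr-src E))) ≃-refl) (≃-cast (idH (R.src L ∘ arr E) ×H a))) ⟩
           (endpoints b ⊚ evalH ta sb) ⊚ E×a            ∎))
      where
        E = expH a b
        sa = R.src L ∘ arr a
        ta = R.tgt L ∘ arr a
        sb = R.src L ∘ arr b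
        tb = R.tgt L ∘ arr b
        E×sa : Hm (prod₀ (exp₀ A B) sa) (prod₀ (exp₀ sa tb) sa)
        E×sa = cast ≈.refl (prod₀-cong (exp₀-cong (≈.sym (arr-src a)) (≈.sym (arr-tgt b))) ≈.refl) (E ×H idH sa)
        E×a : Hm (prod₀ (R.src L ∘ arr E) A') (prod₀ (exp₀ ta sb) ta)
        E×a = cast ≈.refl (prod₀-cong (≈.trans (arr-src E) (exp₀-cong (≈.sym (arr-tgt a)) (≈.sym (arr-src b)))) (≈.sym (arr-tgt a)))
                   (idH (R.src L ∘ arr E) ×H a)

  -- Reindexing and face maps

  record StrictCCFunctor (L N : Lvl p) (J J' : Obj) : Set (o ⊔ ℓ ⊔ e) where
    field
      F₀      : J ⇒ R.Ob L → J' ⇒ R.Ob N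
      F₁      : ∀ {A B} → HomAt L A B → HomAt N (F₀ A) (F₀ B)
      F₁-cong : ∀ {A B A' B'} {f : HomAt L A B} {f' : HomAt L A' B'} → f ≃ f' → F₁ f ≃ F₁ f'
      F₁-⊚    : ∀ {A B D} (g : HomAt L B D) (f : HomAt L A B) → F₁ (g ⊚ f) ≃ F₁ g ⊚ F₁ f
      F₁-idH  : ∀ A → F₁ (idH A) ≃ idH (F₀ A)
      F₀-prod : ∀ A B → F₀ (prod₀ L A B) ≈ prod₀ N (F₀ A) (F₀ B)
      F₀-exp  : ∀ A B → F₀ (exp₀ L A B) ≈ exp₀ N (F₀ A) (F₀ B)
      F₁-fstH  : ∀ A B → F₁ (fstH L A B) ≃ fstH N (F₀ A) (F₀ B)
      F₁-sndH  : ∀ A B → F₁ (sndH L A B) ≃ sndH N (F₀ A) (F₀ B)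
      F₁-evalH : ∀ A B → F₁ (evalH L A B) ≃ evalH N (F₀ A) (F₀ B)

    open ≃-Reasoning

    F₁-pairH : ∀ {Z A B} (f : HomAt L Z A) (g : HomAt L Z B) → F₁ (pairH L f g) ≃ pairH N (F₁ f) (F₁ g)
    F₁-pairH {Z} {A} {B} f g = ≃-trans (≃-cast (F₁ (pairH L f g))) (pairH-unique N c
      (begin
        fstH N (F₀ A) (F₀ B) ⊚ c                ≃˘⟨ ⊚-cong (F₁-fstH A B) (≃-cast (F₁ (pairH L f g))) ⟩
        F₁ (fstH L A B) ⊚ F₁ (pairH L f g)      ≃˘⟨ F₁-⊚ (fstH L A B) (pairH L f g) ⟩
        F₁ (fstH L A B ⊚ pairH L f g)           ≃⟨ F₁-cong (pairH-fst L f g) ⟩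
        F₁ f                                    ∎)
      (begin
        sndH N (F₀ A) (F₀ B) ⊚ c                ≃˘⟨ ⊚-cong (F₁-sndH A B) (≃-cast (F₁ (pairH L f g))) ⟩
        F₁ (sndH L A B) ⊚ F₁ (pairH L f g)      ≃˘⟨ F₁-⊚ (sndH L A B) (pairH L f g) ⟩
        F₁ (sndH L A B ⊚ pairH L f g)           ≃⟨ F₁-cong (pairH-snd L f g) ⟩
        F₁ g                                    ∎))
      where
        c = cast ≈.refl (F₀-prod A B) (F₁ (pairH L f g))

    F₁-×H : ∀ {A A' B B'} (a : HomAt L A A') (b : HomAt L B B') → F₁ (_×H_ L a b) ≃ _×H_ N (F₁ a) (F₁ b)
    F₁-×H {A} {A'} {B} {B'} a b = ≃-trans (≃-cast (F₁ (_×H_ L a b))) (×H-unique N c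
      (begin
        fstH N (F₀ A') (F₀ B') ⊚ c              ≃˘⟨ ⊚-cong (F₁-fstH A' B') (≃-cast (F₁ (_×H_ L a b))) ⟩
        F₁ (fstH L A' B') ⊚ F₁ (_×H_ L a b)     ≃˘⟨ F₁-⊚ (fstH L A' B') (_×H_ L a b) ⟩
        F₁ (fstH L A' B' ⊚ _×H_ L a b)          ≃⟨ F₁-cong (×H-fst L a b) ⟩
        F₁ (a ⊚ fstH L A B)                     ≃⟨ F₁-⊚ a (fstH L A B) ⟩
        F₁ a ⊚ F₁ (fstH L A B)                  ≃⟨ ⊚-cong ≃-refl (F₁-fstH A B) ⟩
        F₁ a ⊚ fstH N (F₀ A) (F₀ B)             ∎)
      (begin
        sndH N (F₀ A') (F₀ B') ⊚ c              ≃˘⟨ ⊚-cong (F₁-sndH A' B') (≃-cast (F₁ (_×H_ L a b))) ⟩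
        F₁ (sndH L A' B') ⊚ F₁ (_×H_ L a b)     ≃˘⟨ F₁-⊚ (sndH L A' B') (_×H_ L a b) ⟩
        F₁ (sndH L A' B' ⊚ _×H_ L a b)          ≃⟨ F₁-cong (×H-snd L a b) ⟩
        F₁ (b ⊚ sndH L A B)                     ≃⟨ F₁-⊚ b (sndH L A B) ⟩
        F₁ b ⊚ F₁ (sndH L A B)                  ≃⟨ ⊚-cong ≃-refl (F₁-sndH A B) ⟩
        F₁ b ⊚ sndH N (F₀ A) (F₀ B)             ∎))
      where
        c = cast (F₀-prod A B) (F₀-prod A' B') (F₁ (_×H_ L a b))

    F₁-×H-idH : ∀ {Z Z' A} (g : HomAt L Z Z') → F₁ (_×H_ L g (idH A)) ≃ _×H_ N (F₁ g) (idH (F₀ A))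
    F₁-×H-idH g = ≃-trans (F₁-×H g (idH _)) (×H-cong N ≃-refl (F₁-idH _))

    F₁-curryH : ∀ {Z A B} (f : HomAt L (prod₀ L Z A) B) →
                F₁ (curryH L f) ≃ curryH N (cast (F₀-prod Z A) ≈.refl (F₁ f))
    F₁-curryH {Z} {A} {B} f = ≃-trans (≃-cast (F₁ (curryH L f))) (curryH-unique N c (begin
      evalH N (F₀ A) (F₀ B) ⊚ _×H_ N c (idH (F₀ A))
        ≃˘⟨ ⊚-cong (F₁-evalH A B) (≃-trans (F₁-×H-idH (curryH L f)) (×H-cong N (≃-cast (F₁ (curryH L f))) ≃-refl)) ⟩
      F₁ (evalH L A B) ⊚ F₁ (_×H_ L (curryH L f) (idH A))    ≃˘⟨ F₁-⊚ (evalH L A B) _ ⟩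
      F₁ (evalH L A B ⊚ _×H_ L (curryH L f) (idH A))         ≃⟨ F₁-cong (curryH-β L f) ⟩
      F₁ f                                                   ≃⟨ ≃-cast (F₁ f) ⟩
      cast (F₀-prod Z A) ≈.refl (F₁ f)                       ∎))
      where
        c = cast ≈.refl (F₀-exp A B) (F₁ (curryH L f))

    F₁-expH : ∀ {A A' B B'} (a : HomAt L A' A) (b : HomAt L B B') → F₁ (expH L a b) ≃ expH N (F₁ a) (F₁ b)
    F₁-expH {A} {A'} {B} {B'} a b = ≃-trans (≃-cast (F₁ (expH L a b))) (expH-unique N c (begin
      evalH N (F₀ A') (F₀ B') ⊚ _×H_ N c (idH (F₀ A'))
        ≃˘⟨ ⊚-cong (F₁-evalH A' B') (≃-trans (F₁-×H-idH (expH L a b)) (×H-cong N (≃-cast (F₁ (expH L a b))) ≃-refl)) ⟩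
      F₁ (evalH L A' B') ⊚ F₁ (_×H_ L (expH L a b) (idH A'))    ≃˘⟨ F₁-⊚ (evalH L A' B') _ ⟩
      F₁ (evalH L A' B' ⊚ _×H_ L (expH L a b) (idH A'))         ≃⟨ F₁-cong (expH-β L a b) ⟩
      F₁ (b ⊚ (evalH L A B ⊚ _×H_ L (idH (exp₀ L A B)) a))      ≃⟨ ≃-trans (F₁-⊚ b _) (⊚-cong ≃-refl (F₁-⊚ (evalH L A B) _)) ⟩
      F₁ b ⊚ (F₁ (evalH L A B) ⊚ F₁ (_×H_ L (idH (exp₀ L A B)) a))
        ≃⟨ ⊚-cong ≃-refl (⊚-cong (F₁-evalH A B) (≃-trans (F₁-×H (idH (exp₀ L A B)) a)
             (×H-cong N (≃-trans (F₁-idH (exp₀ L A B)) (idH-cong (F₀-exp A B))) ≃-refl))) ⟩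
      F₁ b ⊚ (evalH N (F₀ A) (F₀ B) ⊚ _×H_ N (idH (exp₀ N (F₀ A) (F₀ B))) (F₁ a))   ∎))
      where
        c = cast (F₀-exp A B) (F₀-exp A' B') (F₁ (expH L a b))

  module _ (L : Lvl p) {J J' : Obj} (u : J' ⇒ J) where
    ⟨⟩-reindex : ∀ {Y} (K : R.Ob L × R.Ob L ⇒ Y) (A B : J ⇒ R.Ob L) → (K ∘ ⟨ A , B ⟩) ∘ u ≈ K ∘ ⟨ A ∘ u , B ∘ u ⟩
    ⟨⟩-reindex K A B = ≈.trans assoc (∘-congˡ K ⟨⟩∘)

    reindexing : StrictCCFunctor L L J J'
    reindexing = record
      { F₀ = _∘ u
      ; F₁ = reindex u
      ; F₁-cong = reindex-cong u
      ; F₁-⊚ = reindex-⊚ u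
      ; F₁-idH = λ A → reindex-idH u A
      ; F₀-prod = ⟨⟩-reindex (prod L)
      ; F₀-exp = ⟨⟩-reindex (exp L)
      ; F₁-fstH = λ A B → ≈⇒≃ (⟨⟩-reindex (fst L) A B)
      ; F₁-sndH = λ A B → ≈⇒≃ (⟨⟩-reindex (snd L) A B)
      ; F₁-evalH = λ A B → ≈⇒≃ (⟨⟩-reindex (eval L) A B)
      }

  module Reindex (L : Lvl p) {J J' : Obj} (u : J' ⇒ J) = StrictCCFunctor (reindexing L u)

  hob²-⟨⟩ : ∀ {L N} (g : Gen p L N) {J} (A B : J ⇒ R.Ob L) → hob² g ∘ ⟨ A , B ⟩ ≈ ⟨ hob g ∘ A , hob g ∘ B ⟩
  hob²-⟨⟩ g A B = ≈.trans ⟨⟩∘ (⟨⟩-cong (≈.trans assoc (∘-congˡ (hob g) π₁-β)) (≈.trans assoc (∘-congˡ (hob g) π₂-β)))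

  module _ {L N : Lvl p} (g : Gen p L N) {J : Obj} where
    Rel₁ : ∀ {A B : J ⇒ R.Ob L} → HomAt L A B → HomAt N (hob g ∘ A) (hob g ∘ B)
    Rel₁ f = hom (hmor g ∘ arr f)
      (≈.trans assoc˘ (≈.trans (∘-congʳ (IFun.fsrc (gen g)) _) (≈.trans assoc (∘-congˡ (hob g) (arr-src f)))))
      (≈.trans assoc˘ (≈.trans (∘-congʳ (IFun.ftgt (gen g)) _) (≈.trans assoc (∘-congˡ (hob g) (arr-tgt f)))))

    Rel₁-cong : ∀ {A B A' B' : J ⇒ R.Ob L} {f : HomAt L A B} {f' : HomAt L A' B'} → f ≃ f' → Rel₁ f ≃ Rel₁ f'
    Rel₁-cong (≈⇒≃ w) = ≈⇒≃ (∘-congˡ (hmor g) w)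

    Rel₁-idH : (A : J ⇒ R.Ob L) → Rel₁ (idH A) ≃ idH (hob g ∘ A)
    Rel₁-idH A = ≈⇒≃ (≈.trans assoc˘ (≈.trans (∘-congʳ (IFun.fidm (gen g)) A) assoc))

    opaque
      unfolding _⊚_
      Rel₁-⊚ : ∀ {A B D : J ⇒ R.Ob L} (k : HomAt L B D) (f : HomAt L A B) → Rel₁ (k ⊚ f) ≃ Rel₁ k ⊚ Rel₁ f
      Rel₁-⊚ k f = ≈⇒≃ (IFun.fcomp (gen g) (arr k) (arr f) _ _)

  module _ {L N : Lvl p} (h : Face p L N) {J : Obj} where
    private
      g : Gen p L N
      g = inj₁ h

    ⟨⟩-face : ∀ {Y Y'} {K : R.Ob L × R.Ob L ⇒ Y} {K' : R.Ob N × R.Ob N ⇒ Y'} {l : Y ⇒ Y'} →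
              l ∘ K ≈ K' ∘ hob² g → (A B : J ⇒ R.Ob L) → l ∘ (K ∘ ⟨ A , B ⟩) ≈ K' ∘ ⟨ hob g ∘ A , hob g ∘ B ⟩
    ⟨⟩-face {K' = K'} w A B = ≈.trans assoc˘ (≈.trans (∘-congʳ w _) (≈.trans assoc (∘-congˡ K' (hob²-⟨⟩ g A B))))

    faceFunctor : StrictCCFunctor L N J J
    faceFunctor = record
      { F₀ = hob g ∘_
      ; F₁ = Rel₁ g
      ; F₁-cong = Rel₁-cong g
      ; F₁-⊚ = Rel₁-⊚ g
      ; F₁-idH = Rel₁-idH g
      ; F₀-prod = ⟨⟩-face (prod-face h)
      ; F₀-exp = ⟨⟩-face (exp-face h)
      ; F₁-fstH = λ A B → ≈⇒≃ (⟨⟩-face (fst-face h) A B)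
      ; F₁-sndH = λ A B → ≈⇒≃ (⟨⟩-face (snd-face h) A B)
      ; F₁-evalH = λ A B → ≈⇒≃ (⟨⟩-face (eval-face h) A B)
      }

    one₀-face : hob g ∘ one₀ L {J} ≈ one₀ N
    one₀-face = ≈.trans assoc˘ (∘-congʳ (one-face h) _)

  module FaceAction {L N : Lvl p} (h : Face p L N) {J : Obj} = StrictCCFunctor (faceFunctor h {J})

  -- Degeneracies

  module _ {L N : Lvl p} (h : Degen p L N) where
    private
      g : Gen p L N
      g = inj₂ h

    εH : ∀ {J} (A B : J ⇒ R.Ob L) → HomAt N (hob g ∘ prod₀ L A B) (prod₀ N (hob g ∘ A) (hob g ∘ B))
    εH A B = hom (ε h ∘ ⟨ A , B ⟩) (≈.trans assoc˘ (≈.trans (∘-congʳ (ε-src h) _) assoc))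
                 (≈.trans assoc˘ (≈.trans (∘-congʳ (ε-tgt h) _) (≈.trans assoc (∘-congˡ (prod N) (hob²-⟨⟩ g A B)))))

    M-εH : ∀ {J} (A B : J ⇒ R.Ob L) → M N (arr (εH A B))
    M-εH A B = M-reindex ⟨ A , B ⟩ (ε-M h)

    υH : ∀ {J} (A B : J ⇒ R.Ob L) → HomAt N (hob g ∘ exp₀ L A B) (exp₀ N (hob g ∘ A) (hob g ∘ B))
    υH A B = hom (υ h ∘ ⟨ A , B ⟩) (≈.trans assoc˘ (≈.trans (∘-congʳ (υ-src h) _) assoc))
                 (≈.trans assoc˘ (≈.trans (∘-congʳ (υ-tgt h) _) (≈.trans assoc (∘-congˡ (exp N) (hob²-⟨⟩ g A B)))))

    M-υH : ∀ {J} (A B : J ⇒ R.Ob L) → M N (arr (υH A B))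
    M-υH A B = M-reindex ⟨ A , B ⟩ (υ-M h)

    εH-fst : ∀ {J} (A B : J ⇒ R.Ob L) → fstH N (hob g ∘ A) (hob g ∘ B) ⊚ εH A B ≃ Rel₁ g (fstH L A B)
    εH-fst A B = ≈⇒≃ (≈.trans (≋⇒⊚≈ (fstH N _ _) (εH A B) (≋-∘ {X = cat N} ⟨ A , B ⟩ (ε-fst h))
                                  (≈.sym (≈.trans assoc (∘-congˡ (fst N) (hob²-⟨⟩ g A B)))) ≈.refl) assoc)

    εH-snd : ∀ {J} (A B : J ⇒ R.Ob L) → sndH N (hob g ∘ A) (hob g ∘ B) ⊚ εH A B ≃ Rel₁ g (sndH L A B)
    εH-snd A B = ≈⇒≃ (≈.trans (≋⇒⊚≈ (sndH N _ _) (εH A B) (≋-∘ {X = cat N} ⟨ A , B ⟩ (ε-snd h))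
                                  (≈.sym (≈.trans assoc (∘-congˡ (snd N) (hob²-⟨⟩ g A B)))) ≈.refl) assoc)

    open ≃-Reasoning

    εH-natural : ∀ {J} {A A' B B' : J ⇒ R.Ob L} (a : HomAt L A A') (b : HomAt L B B') →
                 _×H_ N (Rel₁ g a) (Rel₁ g b) ⊚ εH A B ≃ εH A' B' ⊚ Rel₁ g (_×H_ L a b)
    εH-natural {J} {A} {A'} {B} {B'} a b = pairH-ext N _ _
      (begin
        fstH N hA' hB' ⊚ (_×H_ N (Rel₁ g a) (Rel₁ g b) ⊚ εH A B)  ≃˘⟨ ⊚-assoc (fstH N hA' hB') _ _ ⟩
        (fstH N hA' hB' ⊚ _×H_ N (Rel₁ g a) (Rel₁ g b)) ⊚ εH A B  ≃⟨ ⊚-cong (×H-fst N (Rel₁ g a) (Rel₁ g b)) ≃-refl ⟩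
        (Rel₁ g a ⊚ fstH N hA hB) ⊚ εH A B                        ≃⟨ ⊚-assoc (Rel₁ g a) _ _ ⟩
        Rel₁ g a ⊚ (fstH N hA hB ⊚ εH A B)                        ≃⟨ ⊚-cong ≃-refl (εH-fst A B) ⟩
        Rel₁ g a ⊚ Rel₁ g (fstH L A B)                            ≃˘⟨ Rel₁-⊚ g a (fstH L A B) ⟩
        Rel₁ g (a ⊚ fstH L A B)                                   ≃˘⟨ Rel₁-cong g (×H-fst L a b) ⟩
        Rel₁ g (fstH L A' B' ⊚ _×H_ L a b)                        ≃⟨ Rel₁-⊚ g (fstH L A' B') _ ⟩
        Rel₁ g (fstH L A' B') ⊚ Rel₁ g (_×H_ L a b)               ≃˘⟨ ⊚-cong (εH-fst A' B') ≃-refl ⟩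
        (fstH N hA' hB' ⊚ εH A' B') ⊚ Rel₁ g (_×H_ L a b)         ≃⟨ ⊚-assoc (fstH N hA' hB') _ _ ⟩
        fstH N hA' hB' ⊚ (εH A' B' ⊚ Rel₁ g (_×H_ L a b))         ∎)
      (begin
        sndH N hA' hB' ⊚ (_×H_ N (Rel₁ g a) (Rel₁ g b) ⊚ εH A B)  ≃˘⟨ ⊚-assoc (sndH N hA' hB') _ _ ⟩
        (sndH N hA' hB' ⊚ _×H_ N (Rel₁ g a) (Rel₁ g b)) ⊚ εH A B  ≃⟨ ⊚-cong (×H-snd N (Rel₁ g a) (Rel₁ g b)) ≃-refl ⟩
        (Rel₁ g b ⊚ sndH N hA hB) ⊚ εH A B                        ≃⟨ ⊚-assoc (Rel₁ g b) _ _ ⟩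
        Rel₁ g b ⊚ (sndH N hA hB ⊚ εH A B)                        ≃⟨ ⊚-cong ≃-refl (εH-snd A B) ⟩
        Rel₁ g b ⊚ Rel₁ g (sndH L A B)                            ≃˘⟨ Rel₁-⊚ g b (sndH L A B) ⟩
        Rel₁ g (b ⊚ sndH L A B)                                   ≃˘⟨ Rel₁-cong g (×H-snd L a b) ⟩
        Rel₁ g (sndH L A' B' ⊚ _×H_ L a b)                        ≃⟨ Rel₁-⊚ g (sndH L A' B') _ ⟩
        Rel₁ g (sndH L A' B') ⊚ Rel₁ g (_×H_ L a b)               ≃˘⟨ ⊚-cong (εH-snd A' B') ≃-refl ⟩
        (sndH N hA' hB' ⊚ εH A' B') ⊚ Rel₁ g (_×H_ L a b)         ≃⟨ ⊚-assoc (sndH N hA' hB') _ _ ⟩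
        sndH N hA' hB' ⊚ (εH A' B' ⊚ Rel₁ g (_×H_ L a b))         ∎)
      where
        hA = hob g ∘ A
        hB = hob g ∘ B
        hA' = hob g ∘ A'
        hB' = hob g ∘ B'

    -- The axiom υ-eval at the generic stage Ob × Ob, reindexed along ⟨ A , B ⟩.
    υH-eval : ∀ {J} (A B : J ⇒ R.Ob L) →
              evalH N (hob g ∘ A) (hob g ∘ B) ⊚ (_×H_ N (υH A B) (idH (hob g ∘ A)) ⊚ εH (exp₀ L A B) A)
                ≃ Rel₁ g (evalH L A B)
    υH-eval A B = begin
      evalH N hA hB ⊚ (_×H_ N (υH A B) (idH hA) ⊚ εH (exp₀ L A B) A)
        ≃˘⟨ ⊚-assoc (evalH N hA hB) _ _ ⟩
      (evalH N hA hB ⊚ _×H_ N (υH A B) (idH hA)) ⊚ εH (exp₀ L A B) A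
        ≃˘⟨ ⊚-cong (⊚-cong (≃-trans (Reindex.F₁-evalH N k X₁ X₂) (evalH-cong N X₁k X₂k))
                           (≃-trans (Reindex.F₁-×H-idH N k υ₀) (×H-cong N (≈⇒≃ ≈.refl) (idH-cong X₁k))))
                   (≈⇒≃ (≈.trans assoc (∘-congˡ (ε h) (≈.trans ⟨⟩∘ (⟨⟩-cong ≈.refl π₁-β))))) ⟩
      (reindex k (evalH N X₁ X₂) ⊚ reindex k (_×H_ N υ₀ (idH X₁))) ⊚ reindex k (εH (exp L) π₁)
        ≃˘⟨ ⊚-cong (reindex-⊚ k (evalH N X₁ X₂) _) ≃-refl ⟩
      reindex k V ⊚ reindex k (εH (exp L) π₁)
        ≃˘⟨ reindex-⊚ k V (εH (exp L) π₁) ⟩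
      reindex k (V ⊚ εH (exp L) π₁)
        ≃⟨ ≈⇒≃ (≈.trans (∘-congʳ generic k) assoc) ⟩
      Rel₁ g (evalH L A B) ∎
      where
        k = ⟨ A , B ⟩
        hA = hob g ∘ A
        hB = hob g ∘ B
        X₁ X₂ : R.Ob L × R.Ob L ⇒ R.Ob N
        X₁ = hob g ∘ π₁
        X₂ = hob g ∘ π₂
        X₁k : X₁ ∘ k ≈ hA
        X₁k = ≈.trans assoc (∘-congˡ (hob g) π₁-β)
        X₂k : X₂ ∘ k ≈ hB
        X₂k = ≈.trans assoc (∘-congˡ (hob g) π₂-β)
        υ₀ : HomAt N (hob g ∘ exp L) (exp N ∘ hob² g)
        υ₀ = hom (υ h) (υ-src h) (υ-tgt h)
        V : HomAt N (prod₀ N (hob g ∘ exp L) X₁) X₂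
        V = evalH N X₁ X₂ ⊚ _×H_ N υ₀ (idH X₁)
        generic : arr (V ⊚ εH (exp L) π₁) ≈ hmor g ∘ eval L
        generic with υ-eval h
        ... | m , c , m-isProd , eval∙m≋c , c∙ε≋eval =
          ≋⇒⊚≈ V (εH (exp L) π₁) c∙ε≋eval
               (≋⇒⊚≈ (evalH N X₁ X₂) (_×H_ N υ₀ (idH X₁)) eval∙m≋c ≈.refl (≈.sym (isProdMor⇒≈×H N υ₀ (idH X₁) m-isProd)))
               ≈.refl

  -- The category |Rel|ⁿ → Rel

  module FunctorCategory (n : ℕ) where
    open FunCat n

    Stage : Lvl p → Obj
    Stage L = pow n (R.Ob L)

    degenerate : ∀ {L N} (h : Degen p L N) → Stage L ⇒ Stage N
    degenerate h = powMap n (hob (inj₂ h))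

    faced : ∀ {L N} (h : Face p L N) → Stage L ⇒ Stage N
    faced h = powMap n (hob (inj₁ h))

    srcs tgts : ∀ L m → pow m (R.Ob L) ⇒ pow n (R.Mor L) → pow m (R.Ob L) ⇒ Stage L
    srcs L m f = powMap n (R.src L) ∘ f
    tgts L m f = powMap n (R.tgt L) ∘ f

    Good : ∀ L m → pow m (R.Ob L) ⇒ pow n (R.Mor L) → Set ℓm
    Good L m f = ∀ k → M L (proj n k ∘ f)

    composeAll : ∀ L m (f' f : pow m (R.Ob L) ⇒ pow n (R.Mor L)) →
                 (∀ k → R.Compat L (proj n k ∘ f') (proj n k ∘ f)) → pow m (R.Ob L) ⇒ pow n (R.Mor L)
    composeAll L m f' f ps = tuple n (λ k → R.compose L (proj n k ∘ f') (proj n k ∘ f) (ps k))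

    discreteFunctor : ∀ L (F₀ : Stage L ⇒ R.Ob L) → IFun (D L) (cat L)
    discreteFunctor L F₀ = record
      { fob = F₀
      ; fmor = R.idm L ∘ F₀
      ; fsrc = ≈.trans (arr-src (idH {X = cat L} F₀)) (≈.sym identityʳ)
      ; ftgt = ≈.trans (arr-tgt (idH {X = cat L} F₀)) (≈.sym identityʳ)
      ; fidm = identityʳ
      ; fcomp = fcomp
      }
      where
        fcomp : ∀ {J} (g f : J ⇒ Stage L) (pr : id ∘ g ≈ id ∘ f) q →
                (R.idm L ∘ F₀) ∘ (pb₁ id id ∘ pbpair id id g f pr) ≈
                R.compose L ((R.idm L ∘ F₀) ∘ g) ((R.idm L ∘ F₀) ∘ f) q
        fcomp g f pr q = ≈.trans (∘-congˡ _ pb₁-β) (≈.trans idm∘g (≈.sym compose-identities))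
          where
            g≈f : g ≈ f
            g≈f = ≈.trans (≈.sym identityˡ) (≈.trans pr identityˡ)
            ι = idH {X = cat L} (F₀ ∘ f)
            idm∘g : (R.idm L ∘ F₀) ∘ g ≈ arr ι
            idm∘g = ≈.trans assoc (∘-congˡ (R.idm L) (∘-congˡ F₀ g≈f))
            compose-identities : R.compose L ((R.idm L ∘ F₀) ∘ g) ((R.idm L ∘ F₀) ∘ f) q ≈ arr ι
            compose-identities = ≈.trans (compose-cong {X = cat L} {q' = ≈.trans (arr-src ι) (≈.sym (arr-tgt ι))} idm∘g assoc)
              (≈.trans (compose≈⊚ ι ι _) (≃⇒≈ (⊚-identityˡ ι)))

    F₁≈idm : (F : FObj) (L : Lvl p) → FObj.F₁ F L ≈ R.idm L ∘ FObj.F₀ F L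
    F₁≈idm F L = ≈.trans (≈.sym identityʳ) (IFun.fidm (FObj.fun F L))

    -- Between functors out of a discrete category naturality is automatic.
    discreteNat : ∀ {L J} {F₀ G₀ : J ⇒ R.Ob L} {F₁ G₁ : J ⇒ R.Mor L} → F₁ ≈ R.idm L ∘ F₀ → G₁ ≈ R.idm L ∘ G₀ →
                  HomAt L F₀ G₀ → INat (Disc J) (cat L) F₀ G₀ F₁ G₁
    discreteNat {L} {J} {F₀} {G₀} {F₁} {G₁} fq gq η = record
      { cmp = arr η
      ; cmp-src = arr-src η
      ; cmp-tgt = arr-tgt η
      ; natural = ≃⇒CompEq G₁H η′ η′ F₁H (begin
          G₁H ⊚ η′      ≃⟨ ⊚-cong (≈⇒≃ {f = G₁H} {g = idH G₀} gq) ≃-refl ⟩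
          idH G₀ ⊚ η′   ≃⟨ ⊚-identityˡ η′ ⟩
          η′            ≃˘⟨ ⊚-identityʳ η′ ⟩
          η′ ⊚ idH F₀   ≃˘⟨ ⊚-cong ≃-refl (≈⇒≃ {f = F₁H} {g = idH F₀} fq) ⟩
          η′ ⊚ F₁H      ∎)
      }
      where
        open ≃-Reasoning
        G₁H : HomAt L G₀ G₀
        G₁H = hom G₁ (≈.trans (∘-congˡ (R.src L) gq) (arr-src (idH {X = cat L} G₀)))
                     (≈.trans (∘-congˡ (R.tgt L) gq) (arr-tgt (idH {X = cat L} G₀)))
        F₁H : HomAt L F₀ F₀
        F₁H = hom F₁ (≈.trans (∘-congˡ (R.src L) fq) (arr-src (idH {X = cat L} F₀)))
                     (≈.trans (∘-congˡ (R.tgt L) fq) (arr-tgt (idH {X = cat L} F₀)))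
        η′ : HomAt L F₀ G₀
        η′ = cast identityʳ identityʳ (reindex id η)

    record FObjData : Set (o ⊔ ℓ ⊔ e ⊔ ℓm) where
      field
        F₀      : ∀ L → Stage L ⇒ R.Ob L
        F₀-face : ∀ {L N} (h : Face p L N) → hob (inj₁ h) ∘ F₀ L ≈ F₀ N ∘ faced h
        εF      : ∀ {L N} (h : Degen p L N) → HomAt N (hob (inj₂ h) ∘ F₀ L) (F₀ N ∘ degenerate h)
        M-εF    : ∀ {L N} (h : Degen p L N) → M N (arr (εF h))
        υF      : ∀ L m f → Good L m f → HomAt L (F₀ L ∘ srcs L m f) (F₀ L ∘ tgts L m f)
        M-υF    : ∀ L m f mf → M L (arr (υF L m f mf))
        υF-cong : ∀ L m f f' mf mf' → f ≈ f' → υF L m f mf ≃ υF L m f' mf'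
        υF-id   : ∀ L m (A : pow m (R.Ob L) ⇒ Stage L) mf → υF L m (powMap n (R.idm L) ∘ A) mf ≃ idH (F₀ L ∘ A)
        υF-compose : ∀ L m f' f ps mf'' mf' mf →
                     R._∙_≋_ L (arr (υF L m f' mf')) (arr (υF L m f mf)) (arr (υF L m (composeAll L m f' f ps) mf''))
        υF-reindex : ∀ L m m' f (g : pow m' (R.Ob L) ⇒ pow m (R.Ob L)) mf mfg →
                     υF L m' (f ∘ g) mfg ≃ reindex g (υF L m f mf)

    toFObj : FObjData → FObj
    toFObj d = record
      { fun = λ L → discreteFunctor L (F₀ L)
      ; face₀ = F₀-face
      ; face₁ = λ h → ≈.trans assoc˘ (≈.trans (∘-congʳ (IFun.fidm (gen (inj₁ h))) _)
                        (≈.trans assoc (≈.trans (∘-congˡ _ (F₀-face h)) assoc˘)))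
      ; ε = λ h → discreteNat (≈.trans assoc˘ (≈.trans (∘-congʳ (IFun.fidm (gen (inj₂ h))) _) assoc)) assoc (εF h)
      ; ε-iso = λ h → M-iso (M-εF h)
      ; ε-M = M-εF
      ; υ = λ L m f mf → arr (υF L m f mf)
      ; υ-M = M-υF
      ; υ-src = λ L m f mf → arr-src (υF L m f mf)
      ; υ-tgt = λ L m f mf → arr-tgt (υF L m f mf)
      ; υ-resp = λ L m f f' mf mf' w → ≃⇒≈ (υF-cong L m f f' mf mf' w)
      ; υ-id = λ L m A mf → ≃⇒≈ (υF-id L m A mf)
      ; υ-comp = υF-compose
      ; υ-reindex = λ L m m' f g mf mfg → ≃⇒≈ (υF-reindex L m m' f g mf mfg)
      }
      where open FObjData d

    module _ (F : FObj) where
      εF : ∀ {L N} (h : Degen p L N) → HomAt N (hob (inj₂ h) ∘ FObj.F₀ F L) (FObj.F₀ F N ∘ degenerate h)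
      εF h = hom (INat.cmp (FObj.ε F h)) (INat.cmp-src (FObj.ε F h)) (INat.cmp-tgt (FObj.ε F h))

      υF : ∀ L m f → Good L m f → HomAt L (FObj.F₀ F L ∘ srcs L m f) (FObj.F₀ F L ∘ tgts L m f)
      υF L m f mf = hom (FObj.υ F L m f mf) (FObj.υ-src F L m f mf) (FObj.υ-tgt F L m f mf)

      υF-cong : ∀ L m f f' mf mf' → f ≈ f' → υF L m f mf ≃ υF L m f' mf'
      υF-cong L m f f' mf mf' w = ≈⇒≃ (FObj.υ-resp F L m f f' mf mf' w)

      υF-id : ∀ L m (A : pow m (R.Ob L) ⇒ Stage L) mf → υF L m (powMap n (R.idm L) ∘ A) mf ≃ idH (FObj.F₀ F L ∘ A)
      υF-id L m A mf = ≈⇒≃ (FObj.υ-id F L m A mf)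

      υF-reindex : ∀ L m m' f (g : pow m' (R.Ob L) ⇒ pow m (R.Ob L)) mf mfg →
                   υF L m' (f ∘ g) mfg ≃ reindex g (υF L m f mf)
      υF-reindex L m m' f g mf mfg = ≈⇒≃ (FObj.υ-reindex F L m m' f g mf mfg)

      Iso-εF : ∀ {L N} (h : Degen p L N) → Iso (εF h)
      Iso-εF h = M⇒Iso _ (εF h) (FObj.ε-M F h)

      Iso-υF : ∀ L m f mf → Iso (υF L m f mf)
      Iso-υF L m f mf = M⇒Iso L (υF L m f mf) (FObj.υ-M F L m f mf)

    ηH : ∀ {F G} (θ : FHom F G) L → HomAt L (FObj.F₀ F L) (FObj.F₀ G L)
    ηH θ L = hom (INat.cmp (FHom.η θ L)) (INat.cmp-src (FHom.η θ L)) (INat.cmp-tgt (FHom.η θ L))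

    ηH-face : ∀ {F G} (θ : FHom F G) {L N} (h : Face p L N) → Rel₁ (inj₁ h) (ηH θ L) ≃ reindex (faced h) (ηH θ N)
    ηH-face θ h = ≈⇒≃ (FHom.η-face θ h)

    ηH-degen : ∀ {F G} (θ : FHom F G) {L N} (h : Degen p L N) →
               reindex (degenerate h) (ηH θ N) ⊚ εF F h ≃ εF G h ⊚ Rel₁ (inj₂ h) (ηH θ L)
    ηH-degen {F} {G} θ h = CompEq⇒≃ (reindex (degenerate h) (ηH θ _)) (εF F h) (εF G h) (Rel₁ (inj₂ h) (ηH θ _)) (FHom.η-degen θ h)

    toFHom : ∀ {F G} (η : ∀ L → HomAt L (FObj.F₀ F L) (FObj.F₀ G L)) →
             (∀ {L N} (h : Face p L N) → Rel₁ (inj₁ h) (η L) ≃ reindex (faced h) (η N)) →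
             (∀ {L N} (h : Degen p L N) → reindex (degenerate h) (η N) ⊚ εF F h ≃ εF G h ⊚ Rel₁ (inj₂ h) (η L)) →
             FHom F G
    toFHom {F} {G} η at-face at-degen = record
      { η = λ L → discreteNat (F₁≈idm F L) (F₁≈idm G L) (η L)
      ; η-face = λ h → ≃⇒≈ (at-face h)
      ; η-degen = λ h → ≃⇒CompEq (reindex (degenerate h) (η _)) (εF F h) (εF G h) (Rel₁ (inj₂ h) (η _)) (at-degen h)
      }

    ∘ᶠ≈⊚ : ∀ {F G H} (θ₁ : FHom G H) (θ₂ : FHom F G) L → (θ₁ ∘ᶠ θ₂) L ≈ arr (ηH θ₁ L ⊚ ηH θ₂ L)
    ∘ᶠ≈⊚ θ₁ θ₂ L = compose≈⊚ (ηH θ₁ L) (ηH θ₂ L) _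

    composeF : ∀ {F G H} → FHom G H → FHom F G → FHom F H
    composeF {F} {G} {H} θ₁ θ₂ = toFHom (λ L → ηH θ₁ L ⊚ ηH θ₂ L) at-face at-degen
      where
        open ≃-Reasoning
        at-face : ∀ {L N} (h : Face p L N) → Rel₁ (inj₁ h) (ηH θ₁ L ⊚ ηH θ₂ L) ≃ reindex (faced h) (ηH θ₁ N ⊚ ηH θ₂ N)
        at-face {L} {N} h = ≃-trans (Rel₁-⊚ (inj₁ h) (ηH θ₁ L) (ηH θ₂ L))
                             (≃-trans (⊚-cong (ηH-face θ₁ h) (ηH-face θ₂ h)) (≃-sym (reindex-⊚ (faced h) (ηH θ₁ N) (ηH θ₂ N))))
        at-degen : ∀ {L N} (h : Degen p L N) →
                      reindex (degenerate h) (ηH θ₁ N ⊚ ηH θ₂ N) ⊚ εF F h ≃ εF H h ⊚ Rel₁ (inj₂ h) (ηH θ₁ L ⊚ ηH θ₂ L)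
        at-degen {L} {N} h = begin
          reindex u (a N ⊚ b N) ⊚ εF F h               ≃⟨ ⊚-cong (reindex-⊚ u (a N) (b N)) ≃-refl ⟩
          (reindex u (a N) ⊚ reindex u (b N)) ⊚ εF F h ≃⟨ ⊚-assoc (reindex u (a N)) _ _ ⟩
          reindex u (a N) ⊚ (reindex u (b N) ⊚ εF F h) ≃⟨ ⊚-cong ≃-refl (ηH-degen θ₂ h) ⟩
          reindex u (a N) ⊚ (εF G h ⊚ Rel₁ g (b L))    ≃˘⟨ ⊚-assoc (reindex u (a N)) _ _ ⟩
          (reindex u (a N) ⊚ εF G h) ⊚ Rel₁ g (b L)    ≃⟨ ⊚-cong (ηH-degen θ₁ h) ≃-refl ⟩
          (εF H h ⊚ Rel₁ g (a L)) ⊚ Rel₁ g (b L)       ≃⟨ ⊚-assoc (εF H h) _ _ ⟩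
          εF H h ⊚ (Rel₁ g (a L) ⊚ Rel₁ g (b L))       ≃˘⟨ ⊚-cong ≃-refl (Rel₁-⊚ g (a L) (b L)) ⟩
          εF H h ⊚ Rel₁ g (a L ⊚ b L)                  ∎
          where
            u = degenerate h
            g = inj₂ h
            a = ηH θ₁
            b = ηH θ₂

    one₀-∘ : ∀ L {J J'} (x : J' ⇒ J) → one₀ L ∘ x ≈ one₀ L
    one₀-∘ L x = ≈.trans assoc (∘-congˡ (one L) (!-unique (! ∘ x)))

    into-one₀ : ∀ L {J} {A A' Y Y' : J ⇒ R.Ob L} (f : HomAt L A Y) (g : HomAt L A' Y') →
                A ≈ A' → Y ≈ one₀ L → Y' ≈ one₀ L → f ≃ g
    into-one₀ L f g a y y' = ≃-trans (≃-trans (≃-cast f) (termH-unique L (cast a y f)))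
                                     (≃-sym (≃-trans (≃-cast g) (termH-unique L (cast ≈.refl y' g))))

    ⊤F : FObj
    ⊤F = toFObj record
      { F₀ = λ L → one₀ L
      ; F₀-face = λ h → ≈.trans (one₀-face h) (≈.sym (one₀-∘ _ (faced h)))
      ; εF = λ h → hom (one-degen h ∘ !) (≈.trans assoc˘ (≈.trans (∘-congʳ (one-degen-src h) !) assoc))
                       (≈.trans assoc˘ (≈.trans (∘-congʳ (one-degen-tgt h) !) (≈.sym (one₀-∘ _ (degenerate h)))))
      ; M-εF = λ h → M-reindex ! (one-degen-M h)
      ; υF = υ⊤
      ; M-υF = λ L m f mf → M-id _
      ; υF-cong = λ L m f f' mf mf' w → into-one₀ L _ _ (one≈one L _ _) (one₀-∘ L _) (one₀-∘ L _)
      ; υF-id = λ L m A mf → into-one₀ L _ _ (one≈one L _ _) (one₀-∘ L _) (one₀-∘ L A)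
      ; υF-compose = λ L m f' f ps mf'' mf' mf →
          let υ = cast ≈.refl (one≈one L (tgts L m f) (srcs L m f')) (υ⊤ L m f mf) in
          ⊚≈⇒≋ (υ⊤ L m f' mf') υ
               (≃⇒≈ (into-one₀ L (υ⊤ L m f' mf' ⊚ υ) (υ⊤ L m _ mf'') (one≈one L _ _) (one₀-∘ L _) (one₀-∘ L _)))
               ≈.refl ≈.refl
      ; υF-reindex = λ L m m' f g mf mfg →
          into-one₀ L _ _ (≈.trans (one₀-∘ L _) (≈.sym (one₀-∘∘ L _ g))) (one₀-∘ L _) (one₀-∘∘ L _ g)
      }
      where
        one≈one : ∀ L {J} (x y : J ⇒ Stage L) → one₀ L ∘ x ≈ one₀ L ∘ y
        one≈one L x y = ≈.trans (one₀-∘ L x) (≈.sym (one₀-∘ L y))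
        one₀-∘∘ : ∀ L {J J' J''} (x : J' ⇒ J) (y : J'' ⇒ J') → (one₀ L ∘ x) ∘ y ≈ one₀ L
        one₀-∘∘ L x y = ≈.trans (∘-congʳ (one₀-∘ L x) y) (one₀-∘ L y)
        υ⊤ : ∀ L m f → Good L m f → HomAt L (one₀ L ∘ srcs L m f) (one₀ L ∘ tgts L m f)
        υ⊤ L m f mf = cast ≈.refl (one≈one L (srcs L m f) (tgts L m f)) (idH (one₀ L ∘ srcs L m f))

    !F : ∀ A → FHom A ⊤F
    !F A = toFHom (λ L → termH L (FObj.F₀ A L))
      (λ {L} {N} h → into-one₀ N _ _ (FObj.face₀ A h) (one₀-face h) (one₀-∘ N (faced h)))
      (λ {L} {N} h → into-one₀ N _ _ ≈.refl (one₀-∘ N (degenerate h)) (one₀-∘ N (degenerate h)))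

    !F-unique : ∀ A (f : FHom A ⊤F) → ⌜ f ⌝ ≈ᶠ ⌜ !F A ⌝
    !F-unique A f L = ≃⇒≈ (termH-unique L (ηH f L))

    module _ (A B : FObj) where
      private
        A₀ = FObj.F₀ A
        B₀ = FObj.F₀ B

      εProd : ∀ {L N} (h : Degen p L N) →
              HomAt N (hob (inj₂ h) ∘ prod₀ L (A₀ L) (B₀ L)) (prod₀ N (A₀ N ∘ degenerate h) (B₀ N ∘ degenerate h))
      εProd h = _×H_ _ (εF A h) (εF B h) ⊚ εH h _ _

      υProd : ∀ L m f → Good L m f →
              HomAt L (prod₀ L (A₀ L) (B₀ L) ∘ srcs L m f) (prod₀ L (A₀ L) (B₀ L) ∘ tgts L m f)
      υProd L m f mf = cast (≈.sym (Reindex.F₀-prod L _ _ _)) (≈.sym (Reindex.F₀-prod L _ _ _))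
                            (_×H_ L (υF A L m f mf) (υF B L m f mf))

      infixr 7 _×F_
      _×F_ : FObj
      _×F_ = toFObj record
        { F₀ = λ L → prod₀ L (A₀ L) (B₀ L)
        ; F₀-face = λ h → ≈.trans (FaceAction.F₀-prod h _ _)
                            (≈.trans (prod₀-cong _ (FObj.face₀ A h) (FObj.face₀ B h)) (≈.sym (Reindex.F₀-prod _ (faced h) _ _)))
        ; εF = λ h → cast ≈.refl (≈.sym (Reindex.F₀-prod _ (degenerate h) _ _)) (εProd h)
        ; M-εF = λ h → M-⊚ _ _ _ (M-×H _ _ _ (FObj.ε-M A h) (FObj.ε-M B h)) (M-εH h _ _)
        ; υF = υProd
        ; M-υF = λ L m f mf → M-×H L _ _ (FObj.υ-M A L m f mf) (FObj.υ-M B L m f mf)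
        ; υF-cong = λ L m f f' mf mf' w → cast-cong (×H-cong L (υF-cong A L m f f' mf mf' w) (υF-cong B L m f f' mf mf' w))
        ; υF-id = λ L m X mf → ≃-trans (cast-≃ _) (≃-trans (×H-cong L (υF-id A L m X mf) (υF-id B L m X mf))
                                (≃-trans (×H-idH L _ _) (idH-cong (≈.sym (Reindex.F₀-prod L X _ _)))))
        ; υF-compose = υProd-compose
        ; υF-reindex = λ L m m' f g mf mfg →
            ≃-trans (cast-≃ _) (≃-trans (×H-cong L (υF-reindex A L m m' f g mf mfg) (υF-reindex B L m m' f g mf mfg))
                    (≃-sym (≃-trans (reindex-cong g (cast-≃ _)) (Reindex.F₁-×H L g (υF A L m f mf) (υF B L m f mf)))))
        }
        where
          υProd-compose : ∀ L m f' f ps mf'' mf' mf →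
                          R._∙_≋_ L (arr (υProd L m f' mf')) (arr (υProd L m f mf)) (arr (υProd L m (composeAll L m f' f ps) mf''))
          υProd-compose L m f' f ps mf'' mf' mf =
            ⊚≈⇒≋ (_×H_ L a' b') (_×H_ L (cast ≈.refl (≋-junction a' a wA) a) (cast ≈.refl (≋-junction b' b wB) b))
                 (≃⇒≈ (≃-trans (×H-⊚ L a' b' _ _) (×H-cong L (≋⇒≃ a' a a'' wA) (≋⇒≃ b' b b'' wB))))
                 ≈.refl (≃⇒≈ (×H-cong L (cast-≃ a) (cast-≃ b)))
            where
              a' = υF A L m f' mf'
              a = υF A L m f mf
              a'' = υF A L m (composeAll L m f' f ps) mf''
              b' = υF B L m f' mf'
              b = υF B L m f mf
              b'' = υF B L m (composeAll L m f' f ps) mf''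
              wA = FObj.υ-comp A L m f' f ps mf'' mf' mf
              wB = FObj.υ-comp B L m f' f ps mf'' mf' mf

    module _ {A B : FObj} where
      private
        A₀ = FObj.F₀ A
        B₀ = FObj.F₀ B
      open ≃-Reasoning

      εProd-fst : ∀ {L N} (h : Degen p L N) →
                  fstH N (A₀ N ∘ degenerate h) (B₀ N ∘ degenerate h) ⊚ εProd A B h ≃ εF A h ⊚ Rel₁ (inj₂ h) (fstH L (A₀ L) (B₀ L))
      εProd-fst {L} {N} h = begin
        fstH N _ _ ⊚ (_×H_ N (εF A h) (εF B h) ⊚ εH h _ _)   ≃˘⟨ ⊚-assoc (fstH N _ _) _ _ ⟩
        (fstH N _ _ ⊚ _×H_ N (εF A h) (εF B h)) ⊚ εH h _ _   ≃⟨ ⊚-cong (×H-fst N (εF A h) (εF B h)) ≃-refl ⟩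
        (εF A h ⊚ fstH N _ _) ⊚ εH h _ _                     ≃⟨ ⊚-assoc (εF A h) _ _ ⟩
        εF A h ⊚ (fstH N _ _ ⊚ εH h (A₀ L) (B₀ L))           ≃⟨ ⊚-cong ≃-refl (εH-fst h (A₀ L) (B₀ L)) ⟩
        εF A h ⊚ Rel₁ (inj₂ h) (fstH L (A₀ L) (B₀ L))        ∎

      εProd-snd : ∀ {L N} (h : Degen p L N) →
                  sndH N (A₀ N ∘ degenerate h) (B₀ N ∘ degenerate h) ⊚ εProd A B h ≃ εF B h ⊚ Rel₁ (inj₂ h) (sndH L (A₀ L) (B₀ L))
      εProd-snd {L} {N} h = begin
        sndH N _ _ ⊚ (_×H_ N (εF A h) (εF B h) ⊚ εH h _ _)   ≃˘⟨ ⊚-assoc (sndH N _ _) _ _ ⟩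
        (sndH N _ _ ⊚ _×H_ N (εF A h) (εF B h)) ⊚ εH h _ _   ≃⟨ ⊚-cong (×H-snd N (εF A h) (εF B h)) ≃-refl ⟩
        (εF B h ⊚ sndH N _ _) ⊚ εH h _ _                     ≃⟨ ⊚-assoc (εF B h) _ _ ⟩
        εF B h ⊚ (sndH N _ _ ⊚ εH h (A₀ L) (B₀ L))           ≃⟨ ⊚-cong ≃-refl (εH-snd h (A₀ L) (B₀ L)) ⟩
        εF B h ⊚ Rel₁ (inj₂ h) (sndH L (A₀ L) (B₀ L))        ∎

      εProd-pairH : ∀ {L N} (h : Degen p L N) {Z} (a : HomAt L Z (A₀ L)) (b : HomAt L Z (B₀ L)) →
                    εProd A B h ⊚ Rel₁ (inj₂ h) (pairH L a b) ≃ pairH N (εF A h ⊚ Rel₁ (inj₂ h) a) (εF B h ⊚ Rel₁ (inj₂ h) b)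
      εProd-pairH {L} {N} h a b = pairH-unique N _
        (begin
          fstH N _ _ ⊚ (εProd A B h ⊚ Rel₁ g (pairH L a b))        ≃˘⟨ ⊚-assoc (fstH N _ _) _ _ ⟩
          (fstH N _ _ ⊚ εProd A B h) ⊚ Rel₁ g (pairH L a b)        ≃⟨ ⊚-cong (εProd-fst h) ≃-refl ⟩
          (εF A h ⊚ Rel₁ g (fstH L _ _)) ⊚ Rel₁ g (pairH L a b)    ≃⟨ ⊚-assoc (εF A h) _ _ ⟩
          εF A h ⊚ (Rel₁ g (fstH L _ _) ⊚ Rel₁ g (pairH L a b))    ≃˘⟨ ⊚-cong ≃-refl (Rel₁-⊚ g _ _) ⟩
          εF A h ⊚ Rel₁ g (fstH L _ _ ⊚ pairH L a b)               ≃⟨ ⊚-cong ≃-refl (Rel₁-cong g (pairH-fst L a b)) ⟩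
          εF A h ⊚ Rel₁ g a                                        ∎)
        (begin
          sndH N _ _ ⊚ (εProd A B h ⊚ Rel₁ g (pairH L a b))        ≃˘⟨ ⊚-assoc (sndH N _ _) _ _ ⟩
          (sndH N _ _ ⊚ εProd A B h) ⊚ Rel₁ g (pairH L a b)        ≃⟨ ⊚-cong (εProd-snd h) ≃-refl ⟩
          (εF B h ⊚ Rel₁ g (sndH L _ _)) ⊚ Rel₁ g (pairH L a b)    ≃⟨ ⊚-assoc (εF B h) _ _ ⟩
          εF B h ⊚ (Rel₁ g (sndH L _ _) ⊚ Rel₁ g (pairH L a b))    ≃˘⟨ ⊚-cong ≃-refl (Rel₁-⊚ g _ _) ⟩
          εF B h ⊚ Rel₁ g (sndH L _ _ ⊚ pairH L a b)               ≃⟨ ⊚-cong ≃-refl (Rel₁-cong g (pairH-snd L a b)) ⟩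
          εF B h ⊚ Rel₁ g b                                        ∎)
        where
          g = inj₂ h

      π₁F : FHom (A ×F B) A
      π₁F = toFHom (λ L → fstH L (A₀ L) (B₀ L))
        (λ h → ≃-trans (FaceAction.F₁-fstH h _ _)
                 (≃-trans (fstH-cong _ (FObj.face₀ A h) (FObj.face₀ B h)) (≃-sym (Reindex.F₁-fstH _ (faced h) _ _))))
        (λ h → ≃-trans (⊚-cong (Reindex.F₁-fstH _ (degenerate h) _ _) (cast-≃ (εProd A B h))) (εProd-fst h))

      π₂F : FHom (A ×F B) B
      π₂F = toFHom (λ L → sndH L (A₀ L) (B₀ L))
        (λ h → ≃-trans (FaceAction.F₁-sndH h _ _)
                 (≃-trans (sndH-cong _ (FObj.face₀ A h) (FObj.face₀ B h)) (≃-sym (Reindex.F₁-sndH _ (faced h) _ _))))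
        (λ h → ≃-trans (⊚-cong (Reindex.F₁-sndH _ (degenerate h) _ _) (cast-≃ (εProd A B h))) (εProd-snd h))

      pairF : ∀ {Z} → FHom Z A → FHom Z B → FHom Z (A ×F B)
      pairF {Z} a b = toFHom (λ L → pairH L (ηH a L) (ηH b L))
        (λ h → ≃-trans (FaceAction.F₁-pairH h (ηH a _) (ηH b _))
                 (≃-trans (pairH-cong _ (ηH-face a h) (ηH-face b h)) (≃-sym (Reindex.F₁-pairH _ (faced h) (ηH a _) (ηH b _)))))
        at-degen
        where
          at-degen : ∀ {L N} (h : Degen p L N) →
                     reindex (degenerate h) (pairH N (ηH a N) (ηH b N)) ⊚ εF Z h ≃
                     εF (A ×F B) h ⊚ Rel₁ (inj₂ h) (pairH L (ηH a L) (ηH b L))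
          at-degen {L} {N} h = begin
            reindex u (pairH N (ηH a N) (ηH b N)) ⊚ εF Z h
              ≃⟨ ⊚-cong (Reindex.F₁-pairH N u (ηH a N) (ηH b N)) ≃-refl ⟩
            pairH N (reindex u (ηH a N)) (reindex u (ηH b N)) ⊚ εF Z h
              ≃⟨ pairH-⊚ N _ _ (εF Z h) ⟩
            pairH N (reindex u (ηH a N) ⊚ εF Z h) (reindex u (ηH b N) ⊚ εF Z h)
              ≃⟨ pairH-cong N (ηH-degen a h) (ηH-degen b h) ⟩
            pairH N (εF A h ⊚ Rel₁ g (ηH a L)) (εF B h ⊚ Rel₁ g (ηH b L))
              ≃˘⟨ εProd-pairH h (ηH a L) (ηH b L) ⟩
            εProd A B h ⊚ Rel₁ g (pairH L (ηH a L) (ηH b L))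
              ≃⟨ ⊚-cong (≃-cast (εProd A B h)) ≃-refl ⟩
            εF (A ×F B) h ⊚ Rel₁ g (pairH L (ηH a L) (ηH b L))
              ∎
            where
              u = degenerate h
              g = inj₂ h

    module _ (B A : FObj) where
      private
        A₀ = FObj.F₀ A
        B₀ = FObj.F₀ B

      εExp : ∀ {L N} (h : Degen p L N) →
             HomAt N (hob (inj₂ h) ∘ exp₀ L (A₀ L) (B₀ L)) (exp₀ N (A₀ N ∘ degenerate h) (B₀ N ∘ degenerate h))
      εExp h = expH _ (Iso.inv (Iso-εF A h)) (εF B h) ⊚ υH h _ _

      υExp : ∀ L m f → Good L m f →
             HomAt L (exp₀ L (A₀ L) (B₀ L) ∘ srcs L m f) (exp₀ L (A₀ L) (B₀ L) ∘ tgts L m f)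
      υExp L m f mf = cast (≈.sym (Reindex.F₀-exp L _ _ _)) (≈.sym (Reindex.F₀-exp L _ _ _))
                           (expH L (Iso.inv (Iso-υF A L m f mf)) (υF B L m f mf))

      infixr 8 _^F_
      _^F_ : FObj
      _^F_ = toFObj record
        { F₀ = λ L → exp₀ L (A₀ L) (B₀ L)
        ; F₀-face = λ h → ≈.trans (FaceAction.F₀-exp h _ _)
                            (≈.trans (exp₀-cong _ (FObj.face₀ A h) (FObj.face₀ B h)) (≈.sym (Reindex.F₀-exp _ (faced h) _ _)))
        ; εF = λ h → cast ≈.refl (≈.sym (Reindex.F₀-exp _ (degenerate h) _ _)) (εExp h)
        ; M-εF = λ h → M-⊚ _ _ _ (M-expH _ _ _ (M-Iso-inv _ (Iso-εF A h) (FObj.ε-M A h)) (FObj.ε-M B h)) (M-υH h _ _)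
        ; υF = υExp
        ; M-υF = λ L m f mf → M-expH L _ _ (M-Iso-inv L (Iso-υF A L m f mf) (FObj.υ-M A L m f mf)) (FObj.υ-M B L m f mf)
        ; υF-cong = λ L m f f' mf mf' w → cast-cong (expH-cong L
            (inv-cong (Iso-υF A L m f mf) (Iso-υF A L m f' mf') (υF-cong A L m f f' mf mf' w)) (υF-cong B L m f f' mf mf' w))
        ; υF-id = λ L m X mf → ≃-trans (cast-≃ _) (≃-trans (expH-cong L
            (inv-cong (Iso-υF A L m _ mf) (Iso-idH (A₀ L ∘ X)) (υF-id A L m X mf)) (υF-id B L m X mf))
            (≃-trans (expH-idH L _ _) (idH-cong (≈.sym (Reindex.F₀-exp L X _ _)))))
        ; υF-compose = υExp-compose
        ; υF-reindex = λ L m m' f g mf mfg → ≃-trans (cast-≃ _) (≃-trans (expH-cong L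
            (inv-cong (Iso-υF A L m' (f ∘ g) mfg) (Iso-reindex g (Iso-υF A L m f mf)) (υF-reindex A L m m' f g mf mfg))
            (υF-reindex B L m m' f g mf mfg))
            (≃-sym (≃-trans (reindex-cong g (cast-≃ _)) (Reindex.F₁-expH L g _ _))))
        }
        where
          υExp-compose : ∀ L m f' f ps mf'' mf' mf →
                         R._∙_≋_ L (arr (υExp L m f' mf')) (arr (υExp L m f mf)) (arr (υExp L m (composeAll L m f' f ps) mf''))
          υExp-compose L m f' f ps mf'' mf' mf =
            ⊚≈⇒≋ (expH L (Iso.inv ia') b') (expH L (Iso.inv ia) (cast ≈.refl (≋-junction b' b wB) b))
                 (≃⇒≈ (≃-trans (expH-⊚ L _ b' _ _) (expH-cong L
                   (inv-cong (Iso-⊚ ia' ia) (Iso-υF A L m _ mf'') (≋⇒≃ a' a a'' wA))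
                   (≋⇒≃ b' b b'' wB))))
                 ≈.refl (≃⇒≈ (expH-cong L (≈⇒≃ {f = Iso.inv ia} {g = Iso.inv (Iso-υF A L m f mf)} ≈.refl) (cast-≃ b)))
            where
              a' = υF A L m f' mf'
              a = υF A L m f mf
              a'' = υF A L m (composeAll L m f' f ps) mf''
              b' = υF B L m f' mf'
              b = υF B L m f mf
              b'' = υF B L m (composeAll L m f' f ps) mf''
              wA = FObj.υ-comp A L m f' f ps mf'' mf' mf
              wB = FObj.υ-comp B L m f' f ps mf'' mf' mf
              ia' = Iso-υF A L m f' mf'
              ia = Iso-cast ≈.refl (≋-junction a' a wA) (Iso-υF A L m f mf)

    module _ {A B : FObj} where
      private
        A₀ = FObj.F₀ A
        B₀ = FObj.F₀ B
      open ≃-Reasoning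

      -- The inverse of εF A introduced by εExp cancels against the εF A
      -- in the product, leaving the structure map υH of the exponential.
      eval-εExp : ∀ {L N} (h : Degen p L N) →
                  evalH N (A₀ N ∘ degenerate h) (B₀ N ∘ degenerate h) ⊚ _×H_ N (εExp B A h) (εF A h)
                    ≃ εF B h ⊚ (evalH N (hob (inj₂ h) ∘ A₀ L) (hob (inj₂ h) ∘ B₀ L)
                                 ⊚ _×H_ N (υH h (A₀ L) (B₀ L)) (idH (hob (inj₂ h) ∘ A₀ L)))
      eval-εExp {L} {N} h = begin
        ev' ⊚ ((eN ⊚ υh) ×' aε)
          ≃˘⟨ ⊚-cong ≃-refl (≃-trans (×H-⊚ N eN (idH A') υh aε) (×H-cong N ≃-refl (⊚-identityˡ aε))) ⟩
        ev' ⊚ ((eN ×' idH A') ⊚ (υh ×' aε))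
          ≃˘⟨ ⊚-cong ≃-refl (⊚-cong ≃-refl
                (≃-trans (×H-⊚ N (idH E) aε υh (idH hA)) (×H-cong N (⊚-identityˡ υh) (⊚-identityʳ aε)))) ⟩
        ev' ⊚ ((eN ×' idH A') ⊚ ((idH E ×' aε) ⊚ (υh ×' idH hA)))
          ≃˘⟨ ⊚-assoc ev' _ _ ⟩
        (ev' ⊚ (eN ×' idH A')) ⊚ ((idH E ×' aε) ⊚ (υh ×' idH hA))
          ≃⟨ ⊚-cong (expH-β N aε⁻¹ bε) ≃-refl ⟩
        (bε ⊚ (ev ⊚ (idH E ×' aε⁻¹))) ⊚ ((idH E ×' aε) ⊚ (υh ×' idH hA))
          ≃⟨ ≃-trans (⊚-assoc bε _ _) (⊚-cong ≃-refl (⊚-assoc ev _ _)) ⟩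
        bε ⊚ (ev ⊚ ((idH E ×' aε⁻¹) ⊚ ((idH E ×' aε) ⊚ (υh ×' idH hA))))
          ≃˘⟨ ⊚-cong ≃-refl (⊚-cong ≃-refl (⊚-assoc (idH E ×' aε⁻¹) _ _)) ⟩
        bε ⊚ (ev ⊚ (((idH E ×' aε⁻¹) ⊚ (idH E ×' aε)) ⊚ (υh ×' idH hA)))
          ≃⟨ ⊚-cong ≃-refl (⊚-cong ≃-refl (⊚-cong (≃-trans (×H-⊚ N (idH E) aε⁻¹ (idH E) aε)
               (≃-trans (×H-cong N (⊚-identityˡ (idH E)) (Iso.isoˡ (Iso-εF A h))) (×H-idH N E hA))) ≃-refl)) ⟩
        bε ⊚ (ev ⊚ (idH (prod₀ N E hA) ⊚ (υh ×' idH hA)))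
          ≃⟨ ⊚-cong ≃-refl (⊚-cong ≃-refl (⊚-identityˡ _)) ⟩
        bε ⊚ (ev ⊚ (υh ×' idH hA))
          ∎
        where
          _×'_ = _×H_ N
          A' = A₀ N ∘ degenerate h
          hA = hob (inj₂ h) ∘ A₀ L
          E = exp₀ N hA (hob (inj₂ h) ∘ B₀ L)
          ev' = evalH N A' (B₀ N ∘ degenerate h)
          ev = evalH N hA (hob (inj₂ h) ∘ B₀ L)
          aε = εF A h
          aε⁻¹ = Iso.inv (Iso-εF A h)
          bε = εF B h
          eN = expH N aε⁻¹ bε
          υh = υH h (A₀ L) (B₀ L)

      εF-exp×A : ∀ {L N} (h : Degen p L N) →
                 εF ((B ^F A) ×F A) h ≃ _×H_ N (εExp B A h) (εF A h) ⊚ εH h (exp₀ L (A₀ L) (B₀ L)) (A₀ L)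
      εF-exp×A h = ≃-trans (≈⇒≃ {g = εProd (B ^F A) A h} ≈.refl) (⊚-cong (×H-cong _ (cast-≃ (εExp B A h)) ≃-refl) ≃-refl)

      evalF : FHom ((B ^F A) ×F A) B
      evalF = toFHom (λ L → evalH L (A₀ L) (B₀ L))
        (λ h → ≃-trans (FaceAction.F₁-evalH h _ _)
                 (≃-trans (evalH-cong _ (FObj.face₀ A h) (FObj.face₀ B h)) (≃-sym (Reindex.F₁-evalH _ (faced h) _ _))))
        at-degen
        where
          at-degen : ∀ {L N} (h : Degen p L N) →
                     reindex (degenerate h) (evalH N (A₀ N) (B₀ N)) ⊚ εF ((B ^F A) ×F A) h
                       ≃ εF B h ⊚ Rel₁ (inj₂ h) (evalH L (A₀ L) (B₀ L))
          at-degen {L} {N} h = begin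
            reindex u (evalH N (A₀ N) (B₀ N)) ⊚ εF ((B ^F A) ×F A) h
              ≃⟨ ⊚-cong (Reindex.F₁-evalH N u (A₀ N) (B₀ N)) (εF-exp×A h) ⟩
            ev' ⊚ (_×H_ N (εExp B A h) (εF A h) ⊚ εEA)
              ≃˘⟨ ⊚-assoc ev' _ _ ⟩
            (ev' ⊚ _×H_ N (εExp B A h) (εF A h)) ⊚ εEA
              ≃⟨ ⊚-cong (eval-εExp h) ≃-refl ⟩
            (εF B h ⊚ (ev ⊚ _×H_ N υh (idH hA))) ⊚ εEA
              ≃⟨ ≃-trans (⊚-assoc (εF B h) _ _) (⊚-cong ≃-refl (⊚-assoc ev _ _)) ⟩
            εF B h ⊚ (ev ⊚ (_×H_ N υh (idH hA) ⊚ εEA))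
              ≃⟨ ⊚-cong ≃-refl (υH-eval h (A₀ L) (B₀ L)) ⟩
            εF B h ⊚ Rel₁ (inj₂ h) (evalH L (A₀ L) (B₀ L))
              ∎
            where
              u = degenerate h
              ev' = evalH N (A₀ N ∘ u) (B₀ N ∘ u)
              hA = hob (inj₂ h) ∘ A₀ L
              ev = evalH N hA (hob (inj₂ h) ∘ B₀ L)
              υh = υH h (A₀ L) (B₀ L)
              εEA = εH h (exp₀ L (A₀ L) (B₀ L)) (A₀ L)


    module CurryF {A B Z : FObj} (f : FHom (Z ×F A) B) where
      private
        A₀ = FObj.F₀ A
        B₀ = FObj.F₀ B
        Z₀ = FObj.F₀ Z
      open ≃-Reasoning

      -- Both composites are determined by evaluating them against A, after
      -- precomposing with the isomorphism W onto the domain of Rel(h)(f).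
      module AtDegen {L N : Lvl p} (h : Degen p L N) where
        private
          g : Gen p L N
          g = inj₂ h
          u = degenerate h
          A' = A₀ N ∘ u
          B' = B₀ N ∘ u
          hZ = hob g ∘ Z₀ L
          hA = hob g ∘ A₀ L
          fL = ηH f L
          fN = ηH f N
          cL = curryH L fL
          cN = curryH N fN
          aε = εF A h
          zε = εF Z h
          bε = εF B h
          ev' = evalH N A' B'
          ev = evalH N hA (hob g ∘ B₀ L)
          υh = υH h (A₀ L) (B₀ L)
          εZA = εH h (Z₀ L) (A₀ L)
          εEA = εH h (exp₀ L (A₀ L) (B₀ L)) (A₀ L)
          _×'_ = _×H_ N
          infixr 8 _×'_

        X Y : HomAt N hZ (exp₀ N A' B')
        X = cast ≈.refl (Reindex.F₀-exp N u (A₀ N) (B₀ N)) (reindex u cN ⊚ zε)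
        Y = cast ≈.refl (Reindex.F₀-exp N u (A₀ N) (B₀ N)) (εF (B ^F A) h ⊚ Rel₁ g cL)

        W : HomAt N (hob g ∘ prod₀ L (Z₀ L) (A₀ L)) (prod₀ N hZ A')
        W = (idH hZ ×' aε) ⊚ εZA

        Iso-W : Iso W
        Iso-W = Iso-⊚ (Iso-×H N (Iso-idH hZ) (Iso-εF A h)) (M⇒Iso N εZA (M-εH h (Z₀ L) (A₀ L)))

        slide : (V : HomAt N hZ (exp₀ N A' B')) → (ev' ⊚ (V ×' idH A')) ⊚ W ≃ ev' ⊚ ((V ×' aε) ⊚ εZA)
        slide V = begin
          (ev' ⊚ (V ×' idH A')) ⊚ ((idH hZ ×' aε) ⊚ εZA)   ≃⟨ ⊚-assoc ev' _ _ ⟩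
          ev' ⊚ ((V ×' idH A') ⊚ ((idH hZ ×' aε) ⊚ εZA))   ≃˘⟨ ⊚-cong ≃-refl (⊚-assoc (V ×' idH A') _ _) ⟩
          ev' ⊚ (((V ×' idH A') ⊚ (idH hZ ×' aε)) ⊚ εZA)
            ≃⟨ ⊚-cong ≃-refl (⊚-cong (≃-trans (×H-⊚ N V (idH A') (idH hZ) aε)
                                              (×H-cong N (⊚-identityʳ V) (⊚-identityˡ aε))) ≃-refl) ⟩
          ev' ⊚ ((V ×' aε) ⊚ εZA)                          ∎

        X-side : (ev' ⊚ (X ×' idH A')) ⊚ W ≃ bε ⊚ Rel₁ g fL
        X-side = begin
          (ev' ⊚ (X ×' idH A')) ⊚ W                        ≃⟨ slide X ⟩
          ev' ⊚ ((X ×' aε) ⊚ εZA)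
            ≃˘⟨ ⊚-cong ≃-refl (⊚-cong (≃-trans (×H-⊚ N Rc (idH A') zε aε)
                  (×H-cong N (≃-trans (⊚-cong (cast-≃ (reindex u cN)) ≃-refl) (≃-cast (reindex u cN ⊚ zε))) (⊚-identityˡ aε))) ≃-refl) ⟩
          ev' ⊚ (((Rc ×' idH A') ⊚ (zε ×' aε)) ⊚ εZA)
            ≃⟨ ≃-trans (⊚-cong ≃-refl (⊚-assoc (Rc ×' idH A') _ _)) (≃-sym (⊚-assoc ev' _ _)) ⟩
          (ev' ⊚ (Rc ×' idH A')) ⊚ ((zε ×' aε) ⊚ εZA)
            ≃⟨ ⊚-cong reindexed-β (≃-sym (εF-pair h)) ⟩
          reindex u fN ⊚ εF (Z ×F A) h                     ≃⟨ ηH-degen f h ⟩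
          bε ⊚ Rel₁ g fL                                   ∎
          where
            Rc = cast ≈.refl (Reindex.F₀-exp N u (A₀ N) (B₀ N)) (reindex u cN)
            εF-pair : ∀ {L N} (h : Degen p L N) → εF (Z ×F A) h ≃ εProd Z A h
            εF-pair h = ≈⇒≃ ≈.refl
            reindexed-β : ev' ⊚ (Rc ×' idH A') ≃ reindex u fN
            reindexed-β = begin
              ev' ⊚ (Rc ×' idH A')
                ≃⟨ ⊚-cong ≃-refl (×H-cong N (≃-trans (cast-≃ (reindex u cN)) (Reindex.F₁-curryH N u fN)) ≃-refl) ⟩
              ev' ⊚ (curryH N (cast (Reindex.F₀-prod N u (Z₀ N) (A₀ N)) ≈.refl (reindex u fN)) ×' idH A')
                ≃⟨ curryH-β N _ ⟩
              cast (Reindex.F₀-prod N u (Z₀ N) (A₀ N)) ≈.refl (reindex u fN)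
                ≃⟨ cast-≃ (reindex u fN) ⟩
              reindex u fN                                 ∎

        Y-side : (ev' ⊚ (Y ×' idH A')) ⊚ W ≃ bε ⊚ Rel₁ g fL
        Y-side = begin
          (ev' ⊚ (Y ×' idH A')) ⊚ W                        ≃⟨ slide Y ⟩
          ev' ⊚ ((Y ×' aε) ⊚ εZA)
            ≃˘⟨ ⊚-cong ≃-refl (⊚-cong (≃-trans (×H-⊚ N (εExp B A h) aε (Rel₁ g cL) (idH hA))
                  (×H-cong N (≃-trans (⊚-cong (≈⇒≃ {f = εExp B A h} {g = εF (B ^F A) h} ≈.refl) ≃-refl)
                                      (≃-cast (εF (B ^F A) h ⊚ Rel₁ g cL)))
                             (⊚-identityʳ aε))) ≃-refl) ⟩
          ev' ⊚ (((εExp B A h ×' aε) ⊚ (Rel₁ g cL ×' idH hA)) ⊚ εZA)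
            ≃⟨ ≃-trans (⊚-cong ≃-refl (⊚-assoc (εExp B A h ×' aε) _ _)) (≃-sym (⊚-assoc ev' _ _)) ⟩
          (ev' ⊚ (εExp B A h ×' aε)) ⊚ ((Rel₁ g cL ×' idH hA) ⊚ εZA)
            ≃⟨ ⊚-cong (eval-εExp {A} {B} h) (≃-trans (⊚-cong (×H-cong N ≃-refl (≃-sym (Rel₁-idH g (A₀ L)))) ≃-refl)
                                              (εH-natural h cL (idH (A₀ L)))) ⟩
          (bε ⊚ (ev ⊚ (υh ×' idH hA))) ⊚ (εEA ⊚ Rel₁ g (_×H_ L cL (idH (A₀ L))))
            ≃⟨ ≃-trans (⊚-assoc bε _ _) (⊚-cong ≃-refl (≃-sym (⊚-assoc (ev ⊚ (υh ×' idH hA)) _ _))) ⟩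
          bε ⊚ (((ev ⊚ (υh ×' idH hA)) ⊚ εEA) ⊚ Rel₁ g (_×H_ L cL (idH (A₀ L))))
            ≃⟨ ⊚-cong ≃-refl (⊚-cong (≃-trans (⊚-assoc ev _ _) (υH-eval h (A₀ L) (B₀ L))) ≃-refl) ⟩
          bε ⊚ (Rel₁ g (evalH L (A₀ L) (B₀ L)) ⊚ Rel₁ g (_×H_ L cL (idH (A₀ L))))
            ≃˘⟨ ⊚-cong ≃-refl (Rel₁-⊚ g (evalH L (A₀ L) (B₀ L)) _) ⟩
          bε ⊚ Rel₁ g (evalH L (A₀ L) (B₀ L) ⊚ _×H_ L cL (idH (A₀ L)))
            ≃⟨ ⊚-cong ≃-refl (Rel₁-cong g (curryH-β L fL)) ⟩
          bε ⊚ Rel₁ g fL                                   ∎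

        degenerate-square : reindex u cN ⊚ zε ≃ εF (B ^F A) h ⊚ Rel₁ g cL
        degenerate-square = ≃-trans (≃-cast (reindex u cN ⊚ zε))
          (≃-trans (curryH-ext N X Y (cancelʳ Iso-W (≃-trans X-side (≃-sym Y-side)))) (cast-≃ (εF (B ^F A) h ⊚ Rel₁ g cL)))

      curryF : FHom Z (B ^F A)
      curryF = toFHom (λ L → curryH L (ηH f L))
        (λ {L} {N} h → ≃-trans (FaceAction.F₁-curryH h (ηH f L)) (≃-trans
            (curryH-cong N (FObj.face₀ Z h) (FObj.face₀ A h) (FObj.face₀ B h)
               (cast-cong {a = FaceAction.F₀-prod h (Z₀ L) (A₀ L)} {b = ≈.refl}
                          {a' = Reindex.F₀-prod N (faced h) (Z₀ N) (A₀ N)} {b' = ≈.refl} (ηH-face f h)))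
            (≃-sym (Reindex.F₁-curryH N (faced h) (ηH f N)))))
        AtDegen.degenerate-square

    open CurryF using (curryF)

    module _ {A B Z : FObj} where
      π₁F-pairF : (f : FHom Z A) (g : FHom Z B) → (π₁F {A} {B} ∘ᶠ pairF {A} {B} f g) ≈ᶠ ⌜ f ⌝
      π₁F-pairF f g L = ≈.trans (∘ᶠ≈⊚ (π₁F {A} {B}) (pairF {A} {B} f g) L) (≃⇒≈ (pairH-fst L (ηH f L) (ηH g L)))

      π₂F-pairF : (f : FHom Z A) (g : FHom Z B) → (π₂F {A} {B} ∘ᶠ pairF {A} {B} f g) ≈ᶠ ⌜ g ⌝
      π₂F-pairF f g L = ≈.trans (∘ᶠ≈⊚ (π₂F {A} {B}) (pairF {A} {B} f g) L) (≃⇒≈ (pairH-snd L (ηH f L) (ηH g L)))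

      pairF-unique : (f : FHom Z A) (g : FHom Z B) (h : FHom Z (A ×F B)) →
                     (π₁F {A} {B} ∘ᶠ h) ≈ᶠ ⌜ f ⌝ → (π₂F {A} {B} ∘ᶠ h) ≈ᶠ ⌜ g ⌝ → ⌜ h ⌝ ≈ᶠ ⌜ pairF {A} {B} f g ⌝
      pairF-unique f g h w₁ w₂ L = ≃⇒≈ (pairH-unique L (ηH h L)
        (≈⇒≃ (≈.trans (≈.sym (∘ᶠ≈⊚ (π₁F {A} {B}) h L)) (w₁ L)))
        (≈⇒≃ (≈.trans (≈.sym (∘ᶠ≈⊚ (π₂F {A} {B}) h L)) (w₂ L))))

    module _ {A B Z : FObj} (f : FHom (Z ×F A) B) where
      private
        Λf : FHom Z (B ^F A)
        Λf = curryF {A} {B} {Z} f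
        π₁ᶻ : FHom (Z ×F A) Z
        π₁ᶻ = π₁F {Z} {A}
        π₂ᶻ : FHom (Z ×F A) A
        π₂ᶻ = π₂F {Z} {A}
        π₁ᵉ : FHom ((B ^F A) ×F A) (B ^F A)
        π₁ᵉ = π₁F {B ^F A} {A}
        π₂ᵉ : FHom ((B ^F A) ×F A) A
        π₂ᵉ = π₂F {B ^F A} {A}
        ev : FHom ((B ^F A) ×F A) B
        ev = evalF {A} {B}

      curryF-β : Σ (FHom (Z ×F A) ((B ^F A) ×F A)) λ m →
                   ((π₁ᵉ ∘ᶠ m) ≈ᶠ (Λf ∘ᶠ π₁ᶻ)) ∧ ((π₂ᵉ ∘ᶠ m) ≈ᶠ ⌜ π₂ᶻ ⌝) ∧ ((ev ∘ᶠ m) ≈ᶠ ⌜ f ⌝)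
      curryF-β = m ,
        (λ L → ≈.trans (π₁F-pairF {B ^F A} {A} c π₂ᶻ L) (≈.sym (∘ᶠ≈⊚ Λf π₁ᶻ L))) ,
        π₂F-pairF {B ^F A} {A} c π₂ᶻ ,
        (λ L → ≈.trans (∘ᶠ≈⊚ ev m L) (≃⇒≈ (≃-trans (⊚-cong ≃-refl (m≃c×id L)) (curryH-β L (ηH f L)))))
        where
          c = composeF {Z ×F A} {Z} {B ^F A} Λf π₁ᶻ
          m = pairF {B ^F A} {A} c π₂ᶻ
          m≃c×id : ∀ L → ηH m L ≃ _×H_ L (curryH L (ηH f L)) (idH (FObj.F₀ A L))
          m≃c×id L = ×H-unique L (ηH m L) (pairH-fst L _ _) (≃-trans (pairH-snd L _ _) (≃-sym (⊚-identityˡ _)))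

      curryF-unique : (g : FHom Z (B ^F A)) (m : FHom (Z ×F A) ((B ^F A) ×F A)) →
                      (π₁ᵉ ∘ᶠ m) ≈ᶠ (g ∘ᶠ π₁ᶻ) → (π₂ᵉ ∘ᶠ m) ≈ᶠ ⌜ π₂ᶻ ⌝ → (ev ∘ᶠ m) ≈ᶠ ⌜ f ⌝ →
                      ⌜ g ⌝ ≈ᶠ ⌜ Λf ⌝
      curryF-unique g m w₁ w₂ w₃ L = ≃⇒≈ (curryH-unique L (ηH g L)
        (≃-trans (⊚-cong ≃-refl (≃-sym m≃g×id)) (≈⇒≃ (≈.trans (≈.sym (∘ᶠ≈⊚ ev m L)) (w₃ L)))))
        where
          m≃g×id : ηH m L ≃ _×H_ L (ηH g L) (idH (FObj.F₀ A L))
          m≃g×id = ×H-unique L (ηH m L)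
            (≈⇒≃ (≈.trans (≈.sym (∘ᶠ≈⊚ π₁ᵉ m L)) (≈.trans (w₁ L) (∘ᶠ≈⊚ g π₁ᶻ L))))
            (≃-trans (≈⇒≃ (≈.trans (≈.sym (∘ᶠ≈⊚ π₂ᵉ m L)) (w₂ L))) (≃-sym (⊚-identityˡ _)))

    cartesianClosed : CartesianClosed
    cartesianClosed = record
      { ⊤F = ⊤F
      ; !F = !F
      ; !F-unique = !F-unique
      ; _×F_ = _×F_
      ; π₁F = λ {A} {B} → π₁F {A} {B}
      ; π₂F = λ {A} {B} → π₂F {A} {B}
      ; ⟨_,_⟩F = λ {A} {B} {Z} → pairF {A} {B} {Z}
      ; π₁F-β = λ {A} {B} {Z} → π₁F-pairF {A} {B} {Z}
      ; π₂F-β = λ {A} {B} {Z} → π₂F-pairF {A} {B} {Z}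
      ; ⟨⟩F-unique = λ {A} {B} {Z} → pairF-unique {A} {B} {Z}
      ; _^F_ = _^F_
      ; evalF = λ {A} {B} → evalF {A} {B}
      ; curryF = λ {A} {B} {Z} → curryF {A} {B} {Z}
      ; curryF-β = λ {A} {B} {Z} → curryF-β {A} {B} {Z}
      ; curryF-unique = λ {A} {B} {Z} → curryF-unique {A} {B} {Z}
      }


proposition18 : ∀ {o ℓ e ℓm} (C : Category o ℓ e) (fc : FinitelyComplete C) (p : ℕ∞)
  (Rel : Setup.CubicalCategory C fc p)
  (M : Setup.Cubes.GoodIsos C fc Rel ℓm)
  (T : Setup.Cubes.WithM.StableTerminals C fc Rel M)
  (P : Setup.Cubes.WithM.StableProducts C fc Rel M)
  (E : Setup.Cubes.WithM.WithProducts.StableExponentials C fc Rel M P)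
  (n : ℕ) → Setup.Cubes.WithM.FunCat.CartesianClosed C fc Rel M n
proposition18 C fc p Rel M T P E n = Construction.FunctorCategory.cartesianClosed fc Rel M T P E n
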